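{- Let $\mathcal{C}$ be a profile class such that $\mathrm{pr}(\mathcal{C})$ is a staircase whose maximal overlapping segments are $M_1,\ldots,M_\ell$. Then the $\mathrm{cl}(\mathcal{C})$-minimal sets in $G(\mathcal{C})$ are precisely the $\ell$ sets $M_1,\ldots,M_\ell\subseteq\mathrm{pr}(\mathcal{C})$.
   Context: A partition is a weakly decreasing sequence $\sigma=(\sigma_1,\sigma_2,\ldots)$ of nonnegative integers with finitely many positive terms, with $\sigma_\infty=0$, indices in $[1,\infty]$. The $p$-interval of $\sigma$ is $\{i\in[1,\infty]:\sigma_i=p\}$. For finite nonempty $P$, $\mathrm{pr}(P)=\bigcup_{p\ge0}\{(p,I):I$ inclusion-maximal among nonempty $p$-intervals of members of $P\}$. A profile class $\mathcal{C}$ is an equivalence class of nonempty finite sets of partitions under equality of profiles; $\mathrm{pr}(\mathcal{C})$ is the common profile. Splicing: if $\alpha_i>\beta_{i+1}$, $\alpha\star_i\beta=(\alpha_1,\ldots,\alpha_i,\beta_{i+1},\ldots)$; $\mathrm{cl}(P)$ is the closure under splicing, and $\mathrm{cl}(\mathcal{C})=\mathrm{cl}(P)$ for any $P\in\mathcal{C}$. $G(\mathcal{C})$ is the bipartite graph with parts $\mathrm{cl}(\mathcal{C})$ and $\mathrm{pr}(\mathcal{C})$, $\alpha$ adjacent to $(p,I)$ iff $I$ is the $p$-interval of $\alpha$; $N(Y)$ is the set of neighbors of vertices in $Y$. A set $Y\subseteq\mathrm{pr}(\mathcal{C})$ is $\mathrm{cl}(\mathcal{C})$-minimal if $N(Y)\supseteq\mathrm{cl}(\mathcal{C})$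 but no proper subset of $Y$ has this property. A staircase is a set $\{(p_1,[a_1,b_1]),\ldots,(p_{s+1},[a_{s+1},b_{s+1}])\}$ with $p_1>\cdots>p_{s+1}=0$, $p_1>0$, $a_1=1$, $a_2\ne1$, $a_i\le b_i$, $b_{s+1}=\infty$, and for $i\ge2$, $a_i\in\{b_{i-1},b_{i-1}+1\}$. An overlapping segment is a subset whose elements can be ordered $(q_1,J_1),\ldots,(q_r,J_r)$ with $q_j>q_{j+1}$ and the left endpoint of $J_{j+1}$ equal to the right endpoint of $J_j$; maximal ones are those maximal under inclusion. -}

module Defs where

open import Data.Nat using (ℕ; zero; suc; _≤_; _<_)
open import Data.Product using (Σ; _×_; _,_; ∃; ∃-syntax; proj₁; proj₂)
open import Data.Sum using (_⊎_)
open import Data.Unit using (⊤)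
open import Data.Empty using (⊥)
open import Data.List using (List; []; _∷_; take; drop; _++_)
open import Data.List.Relation.Unary.All using (All)
open import Data.List.Relation.Unary.Linked using (Linked)
open import Data.List.Membership.Propositional using (_∈_)
open import Data.List.Relation.Binary.Subset.Propositional using (_⊆_)
open import Relation.Binary.PropositionalEquality using (_≡_; _≢_)
open import Relation.Nullary using (¬_)
open import Function.Bundles using (_⇔_)

-- A partition σ = (σ₁, σ₂, …) (weakly decreasing, finitely many positive
-- terms) is represented by the list [σ₁, …, σₖ] of its positive terms.

Partition : Set
Partition = List ℕ

IsPartition : Partition → Set
IsPartition σ = All (λ x → 1 ≤ x) σ × Linked (λ x y → y ≤ x) σ

-- Indices in [1, ∞]: fin n (for n ≥ 1) and ∞.
data Idx : Set where
  fin : ℕ → Idx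
  ∞   : Idx

ValidIdx : Idx → Set
ValidIdx (fin n) = 1 ≤ n
ValidIdx ∞       = ⊤

data _≤ᵢ_ : Idx → Idx → Set where
  fin≤fin : ∀ {m n} → m ≤ n → fin m ≤ᵢ fin n
  fin≤∞   : ∀ {m} → fin m ≤ᵢ ∞
  ∞≤∞     : ∞ ≤ᵢ ∞

-- σ_i for a finite index i ≥ 1 (1-indexed; 0 beyond the list)
at : Partition → ℕ → ℕ
at []       _             = 0
at (x ∷ xs) zero          = 0
at (x ∷ xs) (suc zero)    = x
at (x ∷ xs) (suc (suc n)) = at xs (suc n)

val : Partition → Idx → ℕ
val σ (fin n) = at σ n
val σ ∞       = 0

Interval : Set
Interval = ℕ × Idx

left : Interval → ℕ
left = proj₁

right : Interval → Idx
right = proj₂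

_∈ᴵ_ : Idx → Interval → Set
i ∈ᴵ (a , b) = (fin a ≤ᵢ i) × (i ≤ᵢ b)

_⊆ᴵ_ : Interval → Interval → Set
I ⊆ᴵ J = ∀ i → ValidIdx i → i ∈ᴵ I → i ∈ᴵ J

-- I is the (nonempty) p-interval {i ∈ [1,∞] : σ_i = p} of σ.
-- (Nonempty intervals with 1 ≤ a ≤ b are determined by their endpoints.)
IsPInterval : Partition → ℕ → Interval → Set
IsPInterval σ p (a , b) =
  (1 ≤ a) × (fin a ≤ᵢ b) ×
  (∀ i → ValidIdx i → (i ∈ᴵ (a , b) ⇔ (val σ i ≡ p)))

Elem : Set
Elem = ℕ × Interval

InPr : List Partition → Elem → Set
InPr P (p , I) =
  (∃[ α ] (α ∈ P × IsPInterval α p I)) ×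
  (∀ β J → β ∈ P → IsPInterval β p J → I ⊆ᴵ J → J ≡ I)

-- α ⋆ᵢ β = (α₁, …, αᵢ, β_{i+1}, …)   (used only when αᵢ > β_{i+1})
splice : Partition → ℕ → Partition → Partition
splice α i β = take i α ++ drop i β

data InCl (P : List Partition) : Partition → Set where
  base   : ∀ {α} → α ∈ P → InCl P α
  spliced : ∀ {α β} i → 1 ≤ i → InCl P α → InCl P β →
            at β (suc i) < at α i → InCl P (splice α i β)

-- The bipartite graph G(C) and cl(C)-minimal sets
-- (subsets Y of pr(C) are given as finite lists, compared as sets)

-- N(Y) ⊇ cl(P): every α ∈ cl(P) is adjacent to some (p, I) ∈ Y,
-- i.e. I is the p-interval of α.
Covers : List Partition → List Elem → Set
Covers P Y = ∀ α → InCl P α →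
  ∃[ p ] ∃[ I ] (((p , I) ∈ Y) × IsPInterval α p I)

SubPr : List Partition → List Elem → Set
SubPr P Y = ∀ x → x ∈ Y → InPr P x

ClMinimal : List Partition → List Elem → Set
ClMinimal P Y =
  SubPr P Y × Covers P Y ×
  (∀ Z → Z ⊆ Y → ¬ (Y ⊆ Z) → ¬ Covers P Z)

IsStaircase : List Partition → Set
IsStaircase P =
  ∃[ s ] Σ (ℕ → ℕ) λ p → Σ (ℕ → ℕ) λ a → Σ (ℕ → Idx) λ b →
    (∀ x → InPr P x ⇔ (∃[ i ] ((1 ≤ i) × (i ≤ suc s) × (x ≡ (p i , (a i , b i)))))) ×
    (∀ i → 1 ≤ i → i ≤ s → p (suc i) < p i) ×
    (p (suc s) ≡ 0) × (0 < p 1) ×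
    (a 1 ≡ 1) × (a 2 ≢ 1) ×
    (∀ i → 1 ≤ i → i ≤ suc s → fin (a i) ≤ᵢ b i) ×
    (b (suc s) ≡ ∞) ×
    (∀ i → 1 ≤ i → i ≤ s →
       ∃[ n ] ((b i ≡ fin n) × ((a (suc i) ≡ n) ⊎ (a (suc i) ≡ suc n))))

IsOverlappingSegment : List Partition → List Elem → Set
IsOverlappingSegment P Y =
  SubPr P Y ×
  (∃[ r ] Σ (ℕ → ℕ) λ q → Σ (ℕ → Interval) λ J →
    (∀ x → x ∈ Y ⇔ (∃[ j ] ((1 ≤ j) × (j ≤ r) × (x ≡ (q j , J j))))) ×
    (∀ j → 1 ≤ j → suc j ≤ r →
       (q (suc j) < q j) × (fin (left (J (suc j))) ≡ right (J j))))

IsMaxOverlappingSegment : List Partition → List Elem → Set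
IsMaxOverlappingSegment P Y =
  IsOverlappingSegment P Y ×
  (∀ Z → IsOverlappingSegment P Z → Y ⊆ Z → Z ⊆ Y)

-- Call step m joined to step m+1 when b_m = a_{m+1}; the maximal runs of
-- joined steps are the blocks.  The proof rests on a description of cl(P):
-- a positive decreasing list γ lies in cl(P) iff it is supported, i.e. every
-- position x carries a value γ_x = p_m of a step m whose interval contains x.
-- Members of P are supported because their p-intervals lie in maximal ones,
-- which are staircase intervals; splicing preserves support; and a supported
-- list is obtained from P by splicing, one position at a time.  Then
--  (1) every block covers cl(P): in a supported γ, the last step j of the
--      block with γ_{a_j} ≤ p_j has [a_j , b_j] as its p_j-interval;
--  (2) if Y ⊆ pr(P) misses a step of every block, a supported γ that
--      follows one missing step per block is adjacent to no element of Y;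
--      so a cl(P)-minimal set contains a block and, by (1), equals it,
--      while a proper subset of a block covers nothing;
--  (3) overlapping segments lie inside blocks, and each block is one.
-- Hence both kinds of sets are exactly the blocks.
module Submission where

open import Data.Empty using (⊥; ⊥-elim)
open import Data.List using (List; []; _∷_; length; map)
open import Data.List.Properties using (drop-[])
open import Data.List.Membership.Propositional using (_∈_; find)
open import Data.List.Relation.Binary.Subset.Propositional using (_⊆_)
open import Data.List.Relation.Unary.All using (All; []; _∷_)
import Data.List.Relation.Unary.All as All
import Data.List.Relation.Unary.All.Properties as AllP
open import Data.List.Relation.Unary.Any using (here; there)
open import Data.List.Relation.Unary.Linked using (Linked; _∷_)
open import Data.Nat using (ℕ; zero; suc; pred; _+_; _∸_; _≤_; _<_; z≤n; s≤s; _≤?_; _<?_)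
import Data.Nat as ℕ
open import Data.Nat.ListAction using (sum)
open import Data.Nat.Induction using (<-rec)
open import Data.Nat.Properties
open import Data.Product using (_×_; _,_; ∃; ∃-syntax; proj₁; proj₂)
open import Data.Product.Properties using (≡-dec)
open import Data.Sum using (_⊎_; inj₁; inj₂; [_,_]′)
open import Data.Unit using (tt)
open import Function.Bundles using (_⇔_; mk⇔)
open import Relation.Binary using (tri<; tri≈; tri>)
open import Relation.Binary.PropositionalEquality using (_≡_; _≢_; refl; sym; trans; cong; cong₂; subst; subst₂)
open import Relation.Nullary using (¬_; Dec; yes; no; ¬?)
open import Relation.Nullary.Decidable using (_×-dec_; decidable-stable)
open import Defs

open Function.Bundles.Equivalence using (to; from)

_≟ᵢ_ : (i j : Idx) → Dec (i ≡ j)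
fin m ≟ᵢ fin n with m ℕ.≟ n
... | yes refl = yes refl
... | no m≢n = no λ { refl → m≢n refl }
fin m ≟ᵢ ∞ = no λ ()
∞ ≟ᵢ fin n = no λ ()
∞ ≟ᵢ ∞ = yes refl

_≟ᴵ_ : (I J : Interval) → Dec (I ≡ J)
_≟ᴵ_ = ≡-dec ℕ._≟_ _≟ᵢ_

_≟ₑ_ : (x y : Elem) → Dec (x ≡ y)
_≟ₑ_ = ≡-dec ℕ._≟_ _≟ᴵ_

_≤ᵢ?_ : (i j : Idx) → Dec (i ≤ᵢ j)
fin m ≤ᵢ? fin n with m ≤? n
... | yes m≤n = yes (fin≤fin m≤n)
... | no m≰n = no λ { (fin≤fin m≤n) → m≰n m≤n }
fin m ≤ᵢ? ∞ = yes fin≤∞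
∞ ≤ᵢ? fin n = no λ ()
∞ ≤ᵢ? ∞ = yes ∞≤∞

≤ᵢ-refl : ∀ {i} → i ≤ᵢ i
≤ᵢ-refl {fin n} = fin≤fin ≤-refl
≤ᵢ-refl {∞} = ∞≤∞

≤ᵢ-trans : ∀ {i j k} → i ≤ᵢ j → j ≤ᵢ k → i ≤ᵢ k
≤ᵢ-trans (fin≤fin i≤j) (fin≤fin j≤k) = fin≤fin (≤-trans i≤j j≤k)
≤ᵢ-trans (fin≤fin _) fin≤∞ = fin≤∞
≤ᵢ-trans fin≤∞ ∞≤∞ = fin≤∞
≤ᵢ-trans ∞≤∞ ∞≤∞ = ∞≤∞

open import Data.List.Membership.DecPropositional _≟ₑ_ using (_∈?_)
open import Data.List.Relation.Binary.Subset.DecPropositional _≟ₑ_ using (_⊆?_)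

not-⊆-witness : ∀ (Y Z : List Elem) → ¬ (Y ⊆ Z) → ∃ λ x → x ∈ Y × ¬ (x ∈ Z)
not-⊆-witness Y Z Y⊈Z =
  find (AllP.¬All⇒Any¬ (_∈? Z) Y (λ all → Y⊈Z (All.lookup all)))

module Search {Q : ℕ → Set} (Q? : ∀ n → Dec (Q n)) where

  Below : ℕ → Set
  Below N = ∃ λ k → k ≤ N × Q k

  below? : ∀ N → Dec (Below N)
  below? zero with Q? zero
  ... | yes q = yes (0 , z≤n , q)
  ... | no ¬q = no λ { (.0 , z≤n , q) → ¬q q }
  below? (suc N) with Q? (suc N) | below? N
  ... | yes q | _ = yes (suc N , ≤-refl , q)
  ... | no _ | yes (k , k≤N , q) = yes (k , m≤n⇒m≤1+n k≤N , q)
  ... | no ¬q | no ¬below = no λ { (k , k≤ , q) → absent k k≤ q }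
    where
    absent : ∀ k → k ≤ suc N → ¬ Q k
    absent k k≤ q with m≤n⇒m<n∨m≡n k≤
    ... | inj₁ k<1+N = ¬below (k , ≤-pred k<1+N , q)
    ... | inj₂ refl = ¬q q

  least : ∀ N → Below N → ∃ λ m → Q m × m ≤ N × (∀ k → k < m → ¬ Q k)
  least zero (k , k≤0 , q) with n≤0⇒n≡0 k≤0
  ... | refl = 0 , q , z≤n , λ k ()
  least (suc N) found with below? N
  ... | yes belowN = let (m , qm , m≤ , min) = least N belowN in m , qm , m≤n⇒m≤1+n m≤ , min
  ... | no ¬below with found
  ... | (k , k≤ , q) with m≤n⇒m<n∨m≡n k≤
  ... | inj₁ k<1+N = ⊥-elim (¬below (k , ≤-pred k<1+N , q))
  ... | inj₂ refl = suc N , q , ≤-refl , λ j j<k qj → ¬below (j , ≤-pred j<k , qj)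

  greatest : ∀ N → Below N → ∃ λ m → Q m × m ≤ N × (∀ k → m < k → k ≤ N → ¬ Q k)
  greatest N found with Q? N
  ... | yes q = N , q , ≤-refl , λ k N<k k≤N _ → <⇒≱ N<k k≤N
  greatest zero (k , k≤0 , q) | no ¬q with n≤0⇒n≡0 k≤0
  ... | refl = ⊥-elim (¬q q)
  greatest (suc N) (k , k≤ , q) | no ¬q with m≤n⇒m<n∨m≡n k≤
  ... | inj₂ refl = ⊥-elim (¬q q)
  ... | inj₁ k<1+N =
    let (m , qm , m≤N , max) = greatest N (k , ≤-pred k<1+N , q)
    in m , qm , m≤n⇒m≤1+n m≤N , max′ m max
    where
    max′ : ∀ m → (∀ k → m < k → k ≤ N → ¬ Q k) → ∀ k → m < k → k ≤ suc N → ¬ Q k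
    max′ m max j m<j j≤ qj with m≤n⇒m<n∨m≡n j≤
    ... | inj₁ j<1+N = max j m<j (≤-pred j<1+N) qj
    ... | inj₂ refl = ¬q qj

-- Lists as partitions: entries are read with  at  (1-indexed, 0 beyond the
-- end).  Pos and Decr are the two halves of IsPartition in positional form.

Pos : List ℕ → Set
Pos = All (1 ≤_)

Decr : List ℕ → Set
Decr γ = ∀ x → 1 ≤ x → at γ (suc x) ≤ at γ x

partition-decr : ∀ α → Linked (λ x y → y ≤ x) α → Decr α
partition-decr [] _ x _ = z≤n
partition-decr (y ∷ []) _ (suc zero) _ = z≤n
partition-decr (y ∷ []) _ (suc (suc x)) _ = z≤n
partition-decr (y ∷ z ∷ zs) (z≤y ∷ _) (suc zero) _ = z≤y
partition-decr (y ∷ z ∷ zs) (_ ∷ linked) (suc (suc x)) _ =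
  partition-decr (z ∷ zs) linked (suc x) (s≤s z≤n)

decr-tail : ∀ z zs → Decr (z ∷ zs) → Decr zs
decr-tail z zs decr (suc x) _ = decr (suc (suc x)) (s≤s z≤n)

decr-antitone : ∀ γ → Decr γ → ∀ x x' → 1 ≤ x → x ≤ x' → at γ x' ≤ at γ x
decr-antitone γ decr x x' 1≤x x≤x' with m≤n⇒m<n∨m≡n x≤x'
... | inj₂ refl = ≤-refl
decr-antitone γ decr x (suc x') 1≤x _ | inj₁ (s≤s x≤x') =
  ≤-trans (decr x' (≤-trans 1≤x x≤x')) (decr-antitone γ decr x x' 1≤x x≤x')

at-pos-len : ∀ α i → 0 < at α i → i ≤ length α
at-pos-len (x ∷ α) (suc zero) _ = s≤s z≤n
at-pos-len (x ∷ α) (suc (suc i)) pos = s≤s (at-pos-len α (suc i) pos)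

at-beyond : ∀ γ x → length γ < x → at γ x ≡ 0
at-beyond [] x _ = refl
at-beyond (y ∷ ys) (suc (suc x)) (s≤s len<x) = at-beyond ys (suc x) len<x

at-ext : ∀ α β → Pos α → Pos β → (∀ x → 1 ≤ x → at α x ≡ at β x) → α ≡ β
at-ext [] [] _ _ _ = refl
at-ext [] (y ∷ ys) _ (y>0 ∷ _) same = ⊥-elim (<⇒≢ y>0 (same 1 ≤-refl))
at-ext (y ∷ ys) [] (y>0 ∷ _) _ same = ⊥-elim (<⇒≢ y>0 (sym (same 1 ≤-refl)))
at-ext (y ∷ ys) (z ∷ zs) (_ ∷ pys) (_ ∷ pzs) same =
  cong₂ _∷_ (same 1 ≤-refl)
    (at-ext ys zs pys pzs λ { (suc x) _ → same (suc (suc x)) (s≤s z≤n) })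

splice-left : ∀ i α β x → i ≤ length α → 1 ≤ x → x ≤ i → at (splice α i β) x ≡ at α x
splice-left zero α β x _ 1≤x x≤0 = ⊥-elim (<⇒≱ 1≤x x≤0)
splice-left (suc i) (y ∷ ys) β (suc zero) _ _ _ = refl
splice-left (suc i) (y ∷ ys) [] (suc (suc x)) (s≤s i≤len) _ (s≤s x≤i)
  rewrite sym (drop-[] {A = ℕ} i) = splice-left i ys [] (suc x) i≤len (s≤s z≤n) x≤i
splice-left (suc i) (y ∷ ys) (z ∷ zs) (suc (suc x)) (s≤s i≤len) _ (s≤s x≤i) =
  splice-left i ys zs (suc x) i≤len (s≤s z≤n) x≤i

splice-right : ∀ i α β x → i ≤ length α → i < x → at (splice α i β) x ≡ at β x
splice-right zero α β x _ _ = refl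
splice-right (suc i) (y ∷ ys) [] (suc (suc x)) (s≤s i≤len) (s≤s i<x)
  rewrite sym (drop-[] {A = ℕ} i) = splice-right i ys [] (suc x) i≤len i<x
splice-right (suc i) (y ∷ ys) (z ∷ zs) (suc (suc x)) (s≤s i≤len) (s≤s i<x) =
  splice-right i ys zs (suc x) i≤len i<x

splice-pos : ∀ i α β → Pos α → Pos β → Pos (splice α i β)
splice-pos i α β posα posβ = AllP.++⁺ (AllP.take⁺ i posα) (AllP.drop⁺ i posβ)

descent-within : ∀ i α β → at β (suc i) < at α i → i ≤ length α
descent-within i α β descent = at-pos-len α i (≤-<-trans z≤n descent)

splice-decr : ∀ i α β → at β (suc i) < at α i → Decr α → Decr β → Decr (splice α i β)
splice-decr i α β descent decrα decrβ x 1≤x with <-cmp x i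
... | tri< x<i _ _
  rewrite splice-left i α β (suc x) (descent-within i α β descent) (s≤s z≤n) x<i
        | splice-left i α β x (descent-within i α β descent) 1≤x (<⇒≤ x<i) = decrα x 1≤x
... | tri≈ _ refl _
  rewrite splice-left x α β x (descent-within x α β descent) 1≤x ≤-refl
        | splice-right x α β (suc x) (descent-within x α β descent) ≤-refl = <⇒≤ descent
... | tri> _ _ i<x
  rewrite splice-right i α β (suc x) (descent-within i α β descent) (m≤n⇒m≤1+n i<x)
        | splice-right i α β x (descent-within i α β descent) i<x = decrβ x 1≤x

module InitialRun (Q : ℕ → Set) (Q? : ∀ n → Dec (Q n))
                  (up : ∀ {u w} → u ≤ w → Q u → Q w) (¬Q0 : ¬ Q 0) where

  run : List ℕ → ℕ
  run [] = 0
  run (z ∷ zs) with Q? z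
  ... | yes _ = suc (run zs)
  ... | no _ = 0

  run-spec : ∀ γ → Decr γ → ∀ y → 1 ≤ y → (Q (at γ y) → y ≤ run γ) × (y ≤ run γ → Q (at γ y))
  run-spec [] _ y 1≤y = (λ q → ⊥-elim (¬Q0 q)) , λ y≤0 → ⊥-elim (<⇒≱ 1≤y y≤0)
  run-spec (z ∷ zs) decr y 1≤y with Q? z
  run-spec (z ∷ zs) decr (suc zero) _ | yes qz = (λ _ → s≤s z≤n) , λ _ → qz
  run-spec (z ∷ zs) decr (suc (suc y)) _ | yes qz =
    let (inside , outside) = run-spec zs (decr-tail z zs decr) (suc y) (s≤s z≤n)
    in (λ q → s≤s (inside q)) , λ y≤ → outside (≤-pred y≤)
  ... | no ¬qz = (λ q → ⊥-elim (¬qz (up (decr-antitone (z ∷ zs) decr 1 y ≤-refl 1≤y) q)))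
               , λ y≤0 → ⊥-elim (<⇒≱ 1≤y y≤0)

-- In a decreasing list the value v = γ_x (x ≥ 1) occupies an interval of
-- [1, ∞]: namely [#{y : γ_y > v} + 1 , #{y : γ_y ≥ v}], or [… , ∞] when v = 0.
value-interval : ∀ γ x → Decr γ → 1 ≤ x →
  ∃ λ (I : Interval) → IsPInterval γ (at γ x) I × (fin x ∈ᴵ I)
value-interval γ x decr 1≤x with at γ x in γx≡
... | zero = (suc (Pos.run γ) , ∞) , (s≤s z≤n , fin≤∞ , zero-iff) , (fin≤fin start≤x , fin≤∞)
  where
  module Pos = InitialRun (0 <_) (0 <?_) (λ u≤w 0<u → <-≤-trans 0<u u≤w) (λ ())
  start≤x : suc (Pos.run γ) ≤ x
  start≤x = ≰⇒> (λ x≤ → <-irrefl (sym γx≡) (proj₂ (Pos.run-spec γ decr x 1≤x) x≤))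
  zero-iff : ∀ i → ValidIdx i → (i ∈ᴵ (suc (Pos.run γ) , ∞)) ⇔ (val γ i ≡ 0)
  zero-iff (fin y) 1≤y =
    mk⇔ (λ { (fin≤fin run<y , _) → n≤0⇒n≡0 (≮⇒≥ (λ pos → <⇒≱ run<y (proj₁ (Pos.run-spec γ decr y 1≤y) pos))) })
        (λ γy≡0 → fin≤fin (≰⇒> (λ y≤ → <-irrefl (sym γy≡0) (proj₂ (Pos.run-spec γ decr y 1≤y) y≤))) , fin≤∞)
  zero-iff ∞ _ = mk⇔ (λ _ → refl) (λ _ → fin≤∞ , ∞≤∞)
... | suc v = (suc (Above.run γ) , fin (AtLeast.run γ))
            , (s≤s z≤n , fin≤fin (≤-trans start≤x x≤end) , suc-iff) , (fin≤fin start≤x , fin≤fin x≤end)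
  where
  module Above = InitialRun (suc v <_) (suc v <?_) (λ u≤w v<u → <-≤-trans v<u u≤w) (λ ())
  module AtLeast = InitialRun (suc v ≤_) (suc v ≤?_) (λ u≤w v≤u → ≤-trans v≤u u≤w) (λ ())
  start≤x : suc (Above.run γ) ≤ x
  start≤x = ≰⇒> (λ x≤ → <-irrefl (sym γx≡) (proj₂ (Above.run-spec γ decr x 1≤x) x≤))
  x≤end : x ≤ AtLeast.run γ
  x≤end = proj₁ (AtLeast.run-spec γ decr x 1≤x) (≤-reflexive (sym γx≡))
  suc-iff : ∀ i → ValidIdx i → (i ∈ᴵ (suc (Above.run γ) , fin (AtLeast.run γ))) ⇔ (val γ i ≡ suc v)
  suc-iff (fin y) 1≤y =
    mk⇔ (λ { (fin≤fin run<y , fin≤fin y≤end) →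
             ≤-antisym (≮⇒≥ (λ above → <⇒≱ run<y (proj₁ (Above.run-spec γ decr y 1≤y) above)))
                       (proj₂ (AtLeast.run-spec γ decr y 1≤y) y≤end) })
        (λ γy≡ → fin≤fin (≰⇒> (λ y≤ → <-irrefl (sym γy≡) (proj₂ (Above.run-spec γ decr y 1≤y) y≤)))
               , fin≤fin (proj₁ (AtLeast.run-spec γ decr y 1≤y) (≤-reflexive (sym γy≡))))
  suc-iff ∞ _ = mk⇔ (λ { (_ , ()) }) (λ ())

module Tabulate (f : ℕ → ℕ) (f-decr : ∀ x → 1 ≤ x → f (suc x) ≤ f x) where

  values : ℕ → ℕ → List ℕ
  values k zero = []
  values k (suc n) with f k ℕ.≟ 0
  ... | yes _ = []
  ... | no _ = f k ∷ values (suc k) n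

  f-antitone : ∀ k y → 1 ≤ k → f (k + y) ≤ f k
  f-antitone k zero _ rewrite +-identityʳ k = ≤-refl
  f-antitone k (suc y) 1≤k rewrite +-suc k y =
    ≤-trans (f-decr (k + y) (≤-trans 1≤k (m≤m+n k y))) (f-antitone k y 1≤k)

  values-at : ∀ n k → 1 ≤ k → f (k + n) ≡ 0 → ∀ y → at (values k n) (suc y) ≡ f (k + y)
  values-at zero k 1≤k fkn≡0 y rewrite +-identityʳ k =
    sym (n≤0⇒n≡0 (subst (f (k + y) ≤_) fkn≡0 (f-antitone k y 1≤k)))
  values-at (suc n) k 1≤k fkn≡0 y with f k ℕ.≟ 0
  ... | yes fk≡0 = sym (n≤0⇒n≡0 (subst (f (k + y) ≤_) fk≡0 (f-antitone k y 1≤k)))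
  values-at (suc n) k _ _ zero | no _ rewrite +-identityʳ k = refl
  values-at (suc n) k _ fkn≡0 (suc y) | no _ rewrite +-suc k y =
    values-at n (suc k) (s≤s z≤n) (trans (cong f (sym (+-suc k n))) fkn≡0) y

  values-pos : ∀ n k → Pos (values k n)
  values-pos zero k = []
  values-pos (suc n) k with f k ℕ.≟ 0
  ... | yes _ = []
  ... | no fk≢0 = n≢0⇒n>0 fk≢0 ∷ values-pos n (suc k)

clamp : ℕ → ℕ → ℕ → ℕ
clamp c l h with c ≤? l
... | yes _ = l
... | no _ with c ≤? h
...   | yes _ = c
...   | no _ = h

clamp-range : ∀ c l h → l ≤ h → (l ≤ clamp c l h) × (clamp c l h ≤ h)
clamp-range c l h l≤h with c ≤? l
... | yes _ = ≤-refl , l≤h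
... | no c≰l with c ≤? h
...   | yes c≤h = <⇒≤ (≰⇒> c≰l) , c≤h
...   | no _ = l≤h , ≤-refl

clamp-above : ∀ t c l h → (t ≤ l ⊎ t ≤ c) → t ≤ h → t ≤ clamp c l h
clamp-above t c l h t≤l∨t≤c t≤h with c ≤? l
... | yes c≤l = [ (λ t≤l → t≤l) , (λ t≤c → ≤-trans t≤c c≤l) ]′ t≤l∨t≤c
... | no c≰l with c ≤? h
...   | yes _ = [ (λ t≤l → ≤-trans t≤l (<⇒≤ (≰⇒> c≰l))) , (λ t≤c → t≤c) ]′ t≤l∨t≤c
...   | no _ = t≤h

clamp-mono : ∀ c l h c' l' h' → c ≤ c' → l ≤ l' → h ≤ h' → l ≤ h → clamp c l h ≤ clamp c' l' h'
clamp-mono c l h c' l' h' c≤c' l≤l' h≤h' l≤h with c ≤? l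
... | yes _ = clamp-above l c' l' h' (inj₁ l≤l') (≤-trans l≤h h≤h')
... | no c≰l with c ≤? h
...   | yes c≤h = clamp-above c c' l' h' (inj₂ c≤c') (≤-trans c≤h h≤h')
...   | no c≰h = clamp-above h c' l' h' (inj₂ (≤-trans (<⇒≤ (≰⇒> c≰h)) c≤c')) h≤h'

clamp-below-hi : ∀ c l h j → j < h → clamp c l h ≡ j → c ≤ j
clamp-below-hi c l h j j<h eq with c ≤? l
... | yes c≤l = subst (c ≤_) eq c≤l
... | no _ with c ≤? h
...   | yes _ = ≤-reflexive eq
...   | no _ = ⊥-elim (<-irrefl (sym eq) j<h)

clamp-above-lo : ∀ c l h j → l < j → clamp c l h ≡ j → j ≤ c
clamp-above-lo c l h j l<j eq with c ≤? l
... | yes _ = ⊥-elim (<-irrefl eq l<j)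
... | no _ with c ≤? h
...   | yes _ = ≤-reflexive (sym eq)
...   | no c≰h = subst (_≤ c) eq (<⇒≤ (≰⇒> c≰h))

module Staircase (P : List Partition) (partitions : All IsPartition P)
  (s : ℕ) (p a : ℕ → ℕ) (b : ℕ → Idx)
  (profile : ∀ x → InPr P x ⇔ (∃[ i ] ((1 ≤ i) × (i ≤ suc s) × (x ≡ (p i , (a i , b i))))))
  (p-step : ∀ i → 1 ≤ i → i ≤ s → p (suc i) < p i)
  (p-last : p (suc s) ≡ 0) (a-first : a 1 ≡ 1)
  (a≤b : ∀ i → 1 ≤ i → i ≤ suc s → fin (a i) ≤ᵢ b i)
  (b-last : b (suc s) ≡ ∞)
  (b-next : ∀ i → 1 ≤ i → i ≤ s → ∃[ n ] ((b i ≡ fin n) × ((a (suc i) ≡ n) ⊎ (a (suc i) ≡ suc n))))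
  where

  S : ℕ
  S = suc s

  Step : ℕ → Set
  Step m = (1 ≤ m) × (m ≤ S)

  elem : ℕ → Elem
  elem m = (p m , (a m , b m))

  Within : ℕ → ℕ → Set
  Within m x = (a m ≤ x) × (fin x ≤ᵢ b m)

  step-1 : Step 1
  step-1 = ≤-refl , s≤s z≤n

  step-S : Step S
  step-S = s≤s z≤n , ≤-refl

  p-strict : ∀ m m' → 1 ≤ m → m < m' → m' ≤ S → p m' < p m
  p-strict m (suc m') 1≤m (s≤s m≤m') (s≤s m'≤s) with m≤n⇒m<n∨m≡n m≤m'
  ... | inj₂ refl = p-step m 1≤m m'≤s
  ... | inj₁ m<m' = <-trans (p-step m' (≤-trans 1≤m m≤m') m'≤s) (p-strict m m' 1≤m m<m' (m≤n⇒m≤1+n m'≤s))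

  p-antitone : ∀ m m' → Step m → Step m' → m ≤ m' → p m' ≤ p m
  p-antitone m m' (1≤m , _) (_ , m'≤S) m≤m' with m≤n⇒m<n∨m≡n m≤m'
  ... | inj₁ m<m' = <⇒≤ (p-strict m m' 1≤m m<m' m'≤S)
  ... | inj₂ refl = ≤-refl

  p-reflects : ∀ m m' → Step m → Step m' → p m' ≤ p m → m ≤ m'
  p-reflects m m' (1≤m , m≤S) (1≤m' , _) pm'≤pm = ≮⇒≥ λ m'<m → <⇒≱ (p-strict m' m 1≤m' m'<m m≤S) pm'≤pm

  p-injective : ∀ m m' → Step m → Step m' → p m ≡ p m' → m ≡ m'
  p-injective m m' step step' eq =
    ≤-antisym (p-reflects m m' step step' (≤-reflexive (sym eq))) (p-reflects m' m step' step (≤-reflexive eq))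

  p-zero : ∀ m → Step m → p m ≡ 0 → m ≡ S
  p-zero m step pm≡0 = p-injective m S step step-S (trans pm≡0 (sym p-last))

  finite : Idx → ℕ
  finite (fin n) = n
  finite ∞ = 0

  b-fin : ∀ m → 1 ≤ m → m ≤ s → b m ≡ fin (finite (b m))
  b-fin m 1≤m m≤s with b-next m 1≤m m≤s
  ... | (n , bm≡n , _) rewrite bm≡n = refl

  b-∞ : ∀ m → Step m → b m ≡ ∞ → m ≡ S
  b-∞ m (1≤m , m≤S) bm≡∞ with m≤n⇒m<n∨m≡n m≤S
  ... | inj₂ m≡S = m≡S
  ... | inj₁ m<S with trans (sym bm≡∞) (b-fin m 1≤m (≤-pred m<S))
  ... | ()

  endpoints : ∀ m → 1 ≤ m → m ≤ s →
    (a m ≤ finite (b m)) × (finite (b m) ≤ a (suc m)) × (a (suc m) ≤ suc (finite (b m)))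
  endpoints m 1≤m m≤s with b-next m 1≤m m≤s | a≤b m 1≤m (m≤n⇒m≤1+n m≤s)
  ... | (n , bm≡n , inj₁ next≡n) | am≤bm rewrite bm≡n | next≡n with am≤bm
  ...   | fin≤fin am≤n = am≤n , ≤-refl , n≤1+n n
  endpoints m 1≤m m≤s | (n , bm≡n , inj₂ next≡1+n) | am≤bm rewrite bm≡n | next≡1+n with am≤bm
  ...   | fin≤fin am≤n = am≤n , n≤1+n n , ≤-refl

  a-mono : ∀ m m' → 1 ≤ m → m ≤ m' → m' ≤ S → a m ≤ a m'
  a-mono m m' 1≤m m≤m' m'≤S with m≤n⇒m<n∨m≡n m≤m'
  ... | inj₂ refl = ≤-refl
  a-mono m (suc m') 1≤m _ (s≤s m'≤s) | inj₁ (s≤s m≤m') =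
    let (am'≤bm' , bm'≤next , _) = endpoints m' (≤-trans 1≤m m≤m') m'≤s
    in ≤-trans (a-mono m m' 1≤m m≤m' (m≤n⇒m≤1+n m'≤s)) (≤-trans am'≤bm' bm'≤next)

  b-mono : ∀ m m' → 1 ≤ m → m ≤ m' → m' ≤ S → b m ≤ᵢ b m'
  b-mono m m' 1≤m m≤m' m'≤S with m≤n⇒m<n∨m≡n m≤m'
  ... | inj₂ refl = ≤ᵢ-refl
  b-mono m (suc m') 1≤m _ (s≤s m'≤s) | inj₁ (s≤s m≤m') =
    ≤ᵢ-trans (b-mono m m' 1≤m m≤m' (m≤n⇒m≤1+n m'≤s)) b-step-up
    where
    1≤m' = ≤-trans 1≤m m≤m'
    b-step-up : b m' ≤ᵢ b (suc m')
    b-step-up rewrite b-fin m' 1≤m' m'≤s =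
      ≤ᵢ-trans (fin≤fin (proj₁ (proj₂ (endpoints m' 1≤m' m'≤s)))) (a≤b (suc m') (s≤s z≤n) (s≤s m'≤s))

  a-pos : ∀ m → Step m → 1 ≤ a m
  a-pos m (1≤m , m≤S) = subst (_≤ a m) a-first (a-mono 1 m ≤-refl 1≤m m≤S)

  within-start : ∀ m → Step m → Within m (a m)
  within-start m (1≤m , m≤S) = ≤-refl , a≤b m 1≤m m≤S

  profile-step : ∀ x → InPr P x → ∃ λ m → Step m × (x ≡ elem m)
  profile-step x x∈pr with to (profile x) x∈pr
  ... | (m , 1≤m , m≤S , x≡) = m , (1≤m , m≤S) , x≡

  step-profile : ∀ m → Step m → InPr P (elem m)
  step-profile m (1≤m , m≤S) = from (profile (elem m)) (m , 1≤m , m≤S , refl)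

  SupportedAt : List ℕ → ℕ → Set
  SupportedAt γ x = ∃ λ m → Step m × (at γ x ≡ p m) × Within m x

  Supported : List ℕ → Set
  Supported γ = ∀ x → 1 ≤ x → SupportedAt γ x

  supportedAt? : ∀ γ x → Dec (SupportedAt γ x)
  supportedAt? γ x with Search.below? candidate? S
    where
    candidate? : ∀ m → Dec ((1 ≤ m) × (at γ x ≡ p m) × (a m ≤ x) × (fin x ≤ᵢ b m))
    candidate? m = (1 ≤? m) ×-dec (at γ x ℕ.≟ p m) ×-dec (a m ≤? x) ×-dec (fin x ≤ᵢ? b m)
  ... | yes (m , m≤S , 1≤m , eq , within) = yes (m , (1≤m , m≤S) , eq , within)
  ... | no none = no λ { (m , (1≤m , m≤S) , eq , within) → none (m , m≤S , 1≤m , eq , within) }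

  zero-interval-∞ : ∀ {β v c e} → IsPInterval β v (c , e) → v ≡ 0 → e ≡ ∞
  zero-interval-∞ (_ , _ , iff) refl with from (iff ∞ tt) refl
  ... | (_ , ∞≤∞) = refl

  finite-interval-pos : ∀ {β v c d} → IsPInterval β v (c , fin d) → 0 < v
  finite-interval-pos {v = zero} interval with zero-interval-∞ interval refl
  ... | ()
  finite-interval-pos {v = suc v} _ = s≤s z≤n

  finite-interval-len : ∀ {β v c d} → IsPInterval β v (c , fin d) → d ≤ length β
  finite-interval-len {β} {d = d} interval@(1≤c , fin≤fin c≤d , iff) =
    at-pos-len β d (subst (0 <_) (sym (to (iff (fin d) (≤-trans 1≤c c≤d)) (fin≤fin c≤d , ≤ᵢ-refl)))
                               (finite-interval-pos interval))

  interval-left : ∀ {β v c e c' e'} → IsPInterval β v (c , e) → (c , e) ⊆ᴵ (c' , e') → c' ≤ c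
  interval-left {c = c} (1≤c , c≤e , _) sub with sub (fin c) 1≤c (≤ᵢ-refl , c≤e)
  ... | (fin≤fin c'≤c , _) = c'≤c

  -- the total length of the members of P bounds every finite right endpoint
  total : ℕ
  total = sum (map length P)

  length-total : ∀ {β : Partition} {Q : List Partition} → β ∈ Q → length β ≤ sum (map length Q)
  length-total {Q = _ ∷ Q} (here refl) = m≤m+n _ _
  length-total {Q = q ∷ Q} (there β∈Q) = ≤-trans (length-total {Q = Q} β∈Q) (m≤n+m _ (length q))

  -- a measure on intervals that strictly decreases under strict enlargement
  μ : Interval → ℕ
  μ (c , fin d) = c + (total ∸ d)
  μ (c , ∞) = c

  μ-enlarge : ∀ {β β' v c e c' e'} → β ∈ P → β' ∈ P → IsPInterval β v (c , e) → IsPInterval β' v (c' , e') →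
              (c , e) ⊆ᴵ (c' , e') → (c' , e') ≢ (c , e) → μ (c' , e') < μ (c , e)
  μ-enlarge {e = ∞} {e' = ∞} _ _ I J I⊆J J≢I = ≤∧≢⇒< (interval-left I I⊆J) (λ eq → J≢I (cong (_, ∞) eq))
  μ-enlarge {e = ∞} {e' = fin d'} _ _ I J I⊆J _ with I⊆J ∞ tt (fin≤∞ , ∞≤∞)
  ... | (_ , ())
  μ-enlarge {e = fin d} {e' = ∞} _ _ I (_ , _ , iffJ) _ _ =
    ⊥-elim (<-irrefl refl (subst (0 <_) (sym (to (iffJ ∞ tt) (fin≤∞ , ∞≤∞))) (finite-interval-pos I)))
  μ-enlarge {e = fin d} {c' = c'} {e' = fin d'} _ β'∈P I@(1≤c , fin≤fin c≤d , _) J I⊆J J≢I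
    with I⊆J (fin d) (≤-trans 1≤c c≤d) (fin≤fin c≤d , ≤ᵢ-refl) | m≤n⇒m<n∨m≡n (interval-left I I⊆J)
  ... | (_ , fin≤fin d≤d') | inj₁ c'<c = +-mono-<-≤ c'<c (∸-monoʳ-≤ total d≤d')
  ... | (_ , fin≤fin d≤d') | inj₂ refl with m≤n⇒m<n∨m≡n d≤d'
  ...   | inj₂ refl = ⊥-elim (J≢I refl)
  ...   | inj₁ d<d' =
    +-monoʳ-< c' (∸-monoʳ-< d<d' (≤-trans (finite-interval-len J) (length-total β'∈P)))

  member-decr : ∀ {α} → α ∈ P → Decr α
  member-decr α∈P = partition-decr _ (proj₂ (All.lookup partitions α∈P))

  member-pos : ∀ {α} → α ∈ P → Pos α
  member-pos α∈P = proj₁ (All.lookup partitions α∈P)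

  -- At an unsupported position x with value
  -- v, a v-interval J ∋ x of a member of P is not in pr(P) (those are the
  -- staircase intervals), so it is strictly contained in another one, of
  -- smaller measure; by well-founded induction on μ no such J can exist.
  member-supported : ∀ α → α ∈ P → Supported α
  member-supported α α∈P x 1≤x with supportedAt? α x
  ... | yes supported = supported
  ... | no unsupported =
    ⊥-elim (impossible (μ I) α I refl α∈P (proj₁ (proj₂ α-interval)) (proj₂ (proj₂ α-interval)))
    where
    v = at α x
    α-interval = value-interval α x (member-decr α∈P) 1≤x
    I = proj₁ α-interval

    Impossible : ℕ → Set
    Impossible n = ∀ β J → μ J ≡ n → β ∈ P → IsPInterval β v J → fin x ∈ᴵ J → ⊥

    -- a maximal v-interval through x would be a staircase interval supporting x
    maximal-absurd : ∀ β J → β ∈ P → IsPInterval β v J → fin x ∈ᴵ J →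
                     (∀ β' J' → β' ∈ P → IsPInterval β' v J' → J ⊆ᴵ J' → J' ≡ J) → ⊥
    maximal-absurd β J β∈P J-interval x∈J maximal with profile-step (v , J) ((β , β∈P , J-interval) , maximal)
    ... | (m , step , eq) with cong proj₂ eq
    ... | refl with x∈J
    ... | (fin≤fin am≤x , x≤bm) = unsupported (m , step , cong proj₁ eq , am≤x , x≤bm)

    impossible : ∀ n → Impossible n
    impossible = <-rec Impossible λ n smaller β J μJ≡n β∈P J-interval x∈J →
      maximal-absurd β J β∈P J-interval x∈J λ β' J' β'∈P J'-interval J⊆J' → decidable-stable (J' ≟ᴵ J)
        (λ J'≢J → smaller (subst (μ J' <_) μJ≡n (μ-enlarge β∈P β'∈P J-interval J'-interval J⊆J' J'≢J))
                          β' J' refl β'∈P J'-interval (J⊆J' (fin x) 1≤x x∈J))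

  -- The partitions of cl(P) are positive, decreasing and supported; and
  -- conversely every such list belongs to cl(P).
  record Admissible (γ : List ℕ) : Set where
    field
      pos : Pos γ
      decr : Decr γ
      supported : Supported γ

  splice-supported : ∀ i α β → i ≤ length α → Supported α → Supported β → Supported (splice α i β)
  splice-supported i α β i≤len supα supβ x 1≤x with x ≤? i
  ... | yes x≤i = let (m , step , eq , within) = supα x 1≤x
                  in m , step , trans (splice-left i α β x i≤len 1≤x x≤i) eq , within
  ... | no x≰i = let (m , step , eq , within) = supβ x 1≤x
                 in m , step , trans (splice-right i α β x i≤len (≰⇒> x≰i)) eq , within

  closure-admissible : ∀ {γ} → InCl P γ → Admissible γ
  closure-admissible (base γ∈P) = record
    { pos = member-pos γ∈P ; decr = member-decr γ∈P ; supported = member-supported _ γ∈P }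
  closure-admissible (spliced {α} {β} i _ α∈cl β∈cl descent) = record
    { pos = splice-pos i α β A.pos B.pos
    ; decr = splice-decr i α β descent A.decr B.decr
    ; supported = splice-supported i α β (descent-within i α β descent) A.supported B.supported }
    where
    module A = Admissible (closure-admissible α∈cl)
    module B = Admissible (closure-admissible β∈cl)

  step-member : ∀ m → Step m → ∃ λ β → InCl P β × (∀ y → Within m y → at β y ≡ p m)
  step-member m step with from (profile (elem m)) (m , proj₁ step , proj₂ step , refl)
  ... | ((β , β∈P , (1≤am , _ , iff)) , _) =
    β , base β∈P , λ y (am≤y , y≤bm) → to (iff (fin y) (≤-trans 1≤am am≤y)) (fin≤fin am≤y , y≤bm)

  module Build (γ : List ℕ) (adm : Admissible γ) where
    open Admissible adm

    -- δ ∈ cl(P) agrees with γ up to position n, and beyond n keeps the value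
    -- γ_n = p m over the rest of the interval of a step m containing n.
    record Prefix (n : ℕ) : Set where
      field
        δ : List ℕ
        δ∈cl : InCl P δ
        m : ℕ
        step : Step m
        value : p m ≡ at γ n
        within : Within m n
        agree : ∀ x → 1 ≤ x → x ≤ n → at δ x ≡ at γ x
        keeps : ∀ x → n ≤ x → fin x ≤ᵢ b m → at δ x ≡ p m

    prefix-first : Prefix 1
    prefix-first with supported 1 ≤-refl
    ... | (m , step , γ1≡ , within@(am≤1 , _)) with step-member m step
    ... | (β , β∈cl , constant) = record
      { δ = β ; δ∈cl = β∈cl ; m = m ; step = step ; value = sym γ1≡ ; within = within
      ; agree = λ { (suc zero) _ _ → trans (constant 1 within) (sym γ1≡) ; (suc (suc x)) _ (s≤s ()) }
      ; keeps = λ x 1≤x x≤bm → constant x (≤-trans am≤1 1≤x , x≤bm) }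

    -- if γ does not descend after n, the same δ and step still work at n + 1
    prefix-flat : ∀ n → Prefix n → at γ (suc n) ≡ at γ n → Prefix (suc n)
    prefix-flat n prefix flat = record
      { δ = δ ; δ∈cl = δ∈cl ; m = m ; step = step ; value = trans value (sym flat)
      ; within = ≤-trans (proj₁ within) (n≤1+n n) , n+1≤bm
      ; agree = agree′ ; keeps = λ x n+1≤x → keeps x (≤-trans (n≤1+n n) n+1≤x) }
      where
      open Prefix prefix
      -- the step supporting γ at n + 1 has the value p m, so it is m
      n+1≤bm : fin (suc n) ≤ᵢ b m
      n+1≤bm with supported (suc n) (s≤s z≤n)
      ... | (m' , step' , γ≡pm' , (_ , n+1≤bm')) =
        subst (λ k → fin (suc n) ≤ᵢ b k)
              (p-injective m' m step' step (trans (sym γ≡pm') (trans flat (sym value)))) n+1≤bm'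
      agree′ : ∀ x → 1 ≤ x → x ≤ suc n → at δ x ≡ at γ x
      agree′ x 1≤x x≤ with m≤n⇒m<n∨m≡n x≤
      ... | inj₁ x<n+1 = agree x 1≤x (≤-pred x<n+1)
      ... | inj₂ refl = trans (keeps (suc n) (n≤1+n n) n+1≤bm) (trans value (sym flat))

    -- if γ descends after n, splice δ at n with a member carrying the next step
    prefix-descent : ∀ n → Prefix n → at γ (suc n) < at γ n → Prefix (suc n)
    prefix-descent n prefix descent with supported (suc n) (s≤s z≤n)
    ... | (m' , step' , γn'≡ , within'@(am'≤n' , _)) with step-member m' step'
    ... | (β , β∈cl , constant) = record
      { δ = splice δ n β ; δ∈cl = spliced n 1≤n δ∈cl β∈cl splice-descent
      ; m = m' ; step = step' ; value = sym γn'≡ ; within = within'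
      ; agree = agree′ ; keeps = keeps′ }
      where
      open Prefix prefix
      1≤n : 1 ≤ n
      1≤n = ≤-trans (a-pos m step) (proj₁ within)
      splice-descent : at β (suc n) < at δ n
      splice-descent = subst₂ _<_ (trans γn'≡ (sym (constant (suc n) within')))
                                  (sym (agree n 1≤n ≤-refl)) descent
      n≤len = descent-within n δ β splice-descent
      agree′ : ∀ x → 1 ≤ x → x ≤ suc n → at (splice δ n β) x ≡ at γ x
      agree′ x 1≤x x≤ with m≤n⇒m<n∨m≡n x≤
      ... | inj₁ x<n' = trans (splice-left n δ β x n≤len 1≤x (≤-pred x<n')) (agree x 1≤x (≤-pred x<n'))
      ... | inj₂ refl = trans (splice-right n δ β (suc n) n≤len ≤-refl) (trans (constant _ within') (sym γn'≡))
      keeps′ : ∀ x → suc n ≤ x → fin x ≤ᵢ b m' → at (splice δ n β) x ≡ p m'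
      keeps′ x n'≤x x≤bm' = trans (splice-right n δ β x n≤len n'≤x) (constant x (≤-trans am'≤n' n'≤x , x≤bm'))

    prefix : ∀ n → 1 ≤ n → Prefix n
    prefix (suc zero) _ = prefix-first
    prefix (suc (suc n)) _ with prefix (suc n) (s≤s z≤n) | m≤n⇒m<n∨m≡n (decr (suc n) (s≤s z≤n))
    ... | pre | inj₁ descent = prefix-descent (suc n) pre descent
    ... | pre | inj₂ flat = prefix-flat (suc n) pre flat

    -- at N, just past the end of γ, the step is S (value 0), kept up to ∞;
    -- so δ agrees with γ everywhere
    in-closure : InCl P γ
    in-closure = subst (InCl P) (at-ext δ γ (Admissible.pos (closure-admissible δ∈cl)) pos agree-all) δ∈cl
      where
      N = suc (length γ)
      open Prefix (prefix N (s≤s z≤n))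
      m≡S : m ≡ S
      m≡S = p-zero m step (trans value (at-beyond γ N ≤-refl))
      agree-all : ∀ x → 1 ≤ x → at δ x ≡ at γ x
      agree-all x 1≤x with x ≤? N
      ... | yes x≤N = agree x 1≤x x≤N
      ... | no x≰N =
        trans (keeps x (<⇒≤ (≰⇒> x≰N))
                     (subst (λ k → fin x ≤ᵢ b k) (sym m≡S) (subst (fin x ≤ᵢ_) (sym b-last) fin≤∞)))
              (trans (cong p m≡S) (trans p-last (sym (at-beyond γ x (<-trans ≤-refl (≰⇒> x≰N))))))

  admissible-closure : ∀ γ → Admissible γ → InCl P γ
  admissible-closure γ adm = Build.in-closure γ adm

  Joined : ℕ → Set
  Joined m = b m ≡ fin (a (suc m))

  joined? : ∀ m → Dec (Joined m)
  joined? m = b m ≟ᵢ fin (a (suc m))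

  block : ℕ → ℕ
  block zero = 0
  block (suc m) with joined? m
  ... | yes _ = block m
  ... | no _ = suc (block m)

  block-step : ∀ m → block m ≤ block (suc m)
  block-step m with joined? m
  ... | yes _ = ≤-refl
  ... | no _ = n≤1+n _

  block-mono : ∀ m m' → m ≤ m' → block m ≤ block m'
  block-mono m m' m≤m' with m≤n⇒m<n∨m≡n m≤m'
  ... | inj₂ refl = ≤-refl
  block-mono m (suc m') _ | inj₁ (s≤s m≤m') = ≤-trans (block-mono m m' m≤m') (block-step m')

  joined-block : ∀ m → Joined m → block (suc m) ≡ block m
  joined-block m joined with joined? m
  ... | yes _ = refl
  ... | no ¬joined = ⊥-elim (¬joined joined)

  block-joined : ∀ m m' → m < m' → block m ≡ block m' → Joined m
  block-joined m m' m<m' same with joined? m | block-mono (suc m) m' m<m'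
  ... | yes joined | _ = joined
  ... | no _ | next≤ = ⊥-elim (<-irrefl refl (≤-trans next≤ (≤-reflexive (sym same))))

  block-between : ∀ m k m' → m ≤ k → k ≤ m' → block m ≡ block m' → block k ≡ block m
  block-between m k m' m≤k k≤m' same =
    ≤-antisym (≤-trans (block-mono k m' k≤m') (≤-reflexive (sym same))) (block-mono m k m≤k)

  joined-before-last : ∀ j → Step j → Joined j → j ≤ s
  joined-before-last j (_ , j≤S) joined with m≤n⇒m<n∨m≡n j≤S
  ... | inj₁ j<S = ≤-pred j<S
  ... | inj₂ refl with trans (sym b-last) joined
  ... | ()

  joined-within : ∀ j → Step j → Joined j → Within j (a (suc j))
  joined-within j (1≤j , j≤S) joined =
    ≤-trans aj≤bj bj≤next , subst (fin (a (suc j)) ≤ᵢ_) (sym joined) ≤ᵢ-refl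
    where
    ends = endpoints j 1≤j (joined-before-last j (1≤j , j≤S) joined)
    aj≤bj = proj₁ ends
    bj≤next = proj₁ (proj₂ ends)

  -- Steps whose intervals share a position lie in the same block: intervals
  -- of consecutive steps meet only when the steps are joined.
  shared-position-up : ∀ d m m' → m' ≡ d + m → Step m → Step m' → ∀ y → Within m y → Within m' y →
                       block m ≡ block m'
  shared-position-up zero m .m refl _ _ y _ _ = refl
  shared-position-up (suc d) m m' refl (1≤m , _) step'@(_ , m'≤S) y (_ , y≤bm) within'@(am'≤y , _) =
    trans (sym (joined-block m joined))
          (shared-position-up d (suc m) m' (sym (+-suc d m)) (s≤s z≤n , m+1≤S) step' y (am+1≤y , y≤bnext) within')
    where
    m+1≤m' : suc m ≤ suc d + m
    m+1≤m' = s≤s (m≤n+m m d)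
    m+1≤S = ≤-trans m+1≤m' m'≤S
    m≤s = ≤-pred m+1≤S
    am+1≤y : a (suc m) ≤ y
    am+1≤y = ≤-trans (a-mono (suc m) (suc d + m) (s≤s z≤n) m+1≤m' m'≤S) am'≤y
    ends = endpoints m 1≤m m≤s
    y≤end : y ≤ finite (b m)
    y≤end with subst (fin y ≤ᵢ_) (b-fin m 1≤m m≤s) y≤bm
    ... | fin≤fin y≤n = y≤n
    end≡next : finite (b m) ≡ a (suc m)
    end≡next = ≤-antisym (proj₁ (proj₂ ends)) (≤-trans am+1≤y y≤end)
    joined : Joined m
    joined = trans (b-fin m 1≤m m≤s) (cong fin end≡next)
    y≤bnext : fin y ≤ᵢ b (suc m)
    y≤bnext = ≤ᵢ-trans (fin≤fin (≤-trans y≤end (≤-reflexive end≡next))) (a≤b (suc m) (s≤s z≤n) (s≤s m≤s))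

  shared-position : ∀ m m' → Step m → Step m' → ∀ y → Within m y → Within m' y → block m ≡ block m'
  shared-position m m' step step' y within within' with ≤-total m m'
  ... | inj₁ m≤m' = shared-position-up (m' ∸ m) m m' (sym (m∸n+n≡m m≤m')) step step' y within within'
  ... | inj₂ m'≤m = sym (shared-position-up (m ∸ m') m' m (sym (m∸n+n≡m m'≤m)) step' step y within' within)

  -- The steps whose intervals contain a position x ≥ 1 form the range
  -- [lo x , hi x]: lo x is the first step ending at or after x, hi x the
  -- last step starting at or before x.
  EndsAfter : ℕ → ℕ → Set
  EndsAfter x m = (1 ≤ m) × (fin x ≤ᵢ b m)

  StartsBefore : ℕ → ℕ → Set
  StartsBefore x m = (1 ≤ m) × (a m ≤ suc (pred x))

  -- only the specifications of the searches are used: keep them opaque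
  abstract
    lo-search : ∀ x → ∃ λ m → EndsAfter x m × m ≤ S × (∀ k → k < m → ¬ EndsAfter x k)
    lo-search x = Search.least (λ m → (1 ≤? m) ×-dec (fin x ≤ᵢ? b m)) S
                    (S , ≤-refl , s≤s z≤n , subst (fin x ≤ᵢ_) (sym b-last) fin≤∞)

    hi-search : ∀ x → ∃ λ m → StartsBefore x m × m ≤ S × (∀ k → m < k → k ≤ S → ¬ StartsBefore x k)
    hi-search x = Search.greatest (λ m → (1 ≤? m) ×-dec (a m ≤? suc (pred x))) S
                    (1 , s≤s z≤n , ≤-refl , subst (_≤ suc (pred x)) (sym a-first) (s≤s z≤n))

  lo hi : ℕ → ℕ
  lo x = proj₁ (lo-search x)
  hi x = proj₁ (hi-search x)

  lo-step : ∀ x → Step (lo x)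
  lo-step x = proj₁ (proj₁ (proj₂ (lo-search x))) , proj₁ (proj₂ (proj₂ (lo-search x)))

  hi-step : ∀ x → Step (hi x)
  hi-step x = proj₁ (proj₁ (proj₂ (hi-search x))) , proj₁ (proj₂ (proj₂ (hi-search x)))

  lo-ends-after : ∀ x → fin x ≤ᵢ b (lo x)
  lo-ends-after x = proj₂ (proj₁ (proj₂ (lo-search x)))

  lo-least : ∀ x m → Step m → fin x ≤ᵢ b m → lo x ≤ m
  lo-least x m (1≤m , _) x≤bm = ≮⇒≥ λ m<lo → proj₂ (proj₂ (proj₂ (lo-search x))) m m<lo (1≤m , x≤bm)

  hi-greatest : ∀ x m → 1 ≤ x → Step m → a m ≤ x → m ≤ hi x
  hi-greatest (suc y) m _ (1≤m , m≤S) am≤x =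
    ≮⇒≥ λ hi<m → proj₂ (proj₂ (proj₂ (hi-search (suc y)))) m hi<m m≤S (1≤m , am≤x)

  -- step lo x contains x: the previous step ends before x, and steps are contiguous
  lo-within : ∀ x → 1 ≤ x → Within (lo x) x
  lo-within x 1≤x = starts (lo x) refl , lo-ends-after x
    where
    starts : ∀ k → lo x ≡ k → a (lo x) ≤ x
    starts zero lo≡0 = ⊥-elim (<-irrefl (sym lo≡0) (proj₁ (lo-step x)))
    starts (suc zero) lo≡1 = ≤-trans (≤-reflexive (trans (cong a lo≡1) a-first)) 1≤x
    starts (suc (suc k)) lo≡ with proj₂ (proj₂ (proj₂ (lo-search x))) (suc k) (≤-reflexive (sym lo≡))
    ... | ¬ends rewrite lo≡ =
      ≤-trans (proj₂ (proj₂ (endpoints (suc k) (s≤s z≤n) k+1≤s)))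
              (≰⇒> λ x≤end → ¬ends (s≤s z≤n ,
                 subst (fin x ≤ᵢ_) (sym (b-fin (suc k) (s≤s z≤n) k+1≤s)) (fin≤fin x≤end)))
      where
      k+1≤s : suc k ≤ s
      k+1≤s = ≤-pred (subst (_≤ S) lo≡ (proj₂ (lo-step x)))

  -- step hi x contains x: the next step starts after x, and steps are contiguous
  hi-within : ∀ x → 1 ≤ x → Within (hi x) x
  hi-within (suc y) _ = proj₂ (proj₁ (proj₂ (hi-search (suc y)))) , ends
    where
    h = hi (suc y)
    ends : fin (suc y) ≤ᵢ b h
    ends with m≤n⇒m<n∨m≡n (proj₂ (hi-step (suc y)))
    ... | inj₂ h≡S = subst (fin (suc y) ≤ᵢ_) (sym (trans (cong b h≡S) b-last)) fin≤∞
    ... | inj₁ h<S with proj₂ (proj₂ (proj₂ (hi-search (suc y)))) (suc h) ≤-refl h<S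
    ... | ¬starts =
      subst (fin (suc y) ≤ᵢ_) (sym (b-fin h (proj₁ (hi-step (suc y))) (≤-pred h<S)))
        (fin≤fin (≤-pred (<-≤-trans (≰⇒> λ next≤ → ¬starts (s≤s z≤n , next≤))
                                     (proj₂ (proj₂ (endpoints h (proj₁ (hi-step (suc y))) (≤-pred h<S)))))))

  lo≤hi : ∀ x → 1 ≤ x → lo x ≤ hi x
  lo≤hi x 1≤x = lo-least x (hi x) (hi-step x) (proj₂ (hi-within x 1≤x))

  between-within : ∀ x m → 1 ≤ x → lo x ≤ m → m ≤ hi x → Within m x
  between-within x m 1≤x lo≤m m≤hi =
    ≤-trans (a-mono m (hi x) (≤-trans (proj₁ (lo-step x)) lo≤m) m≤hi (proj₂ (hi-step x))) (proj₁ (hi-within x 1≤x)) ,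
    ≤ᵢ-trans (lo-ends-after x) (b-mono (lo x) m (proj₁ (lo-step x)) lo≤m (≤-trans m≤hi (proj₂ (hi-step x))))

  lo-mono : ∀ x x' → x ≤ x' → lo x ≤ lo x'
  lo-mono x x' x≤x' = lo-least x (lo x') (lo-step x') (≤ᵢ-trans (fin≤fin x≤x') (lo-ends-after x'))

  hi-mono : ∀ x x' → 1 ≤ x → x ≤ x' → hi x ≤ hi x'
  hi-mono x x' 1≤x x≤x' = hi-greatest x' (hi x) (≤-trans 1≤x x≤x') (hi-step x) (≤-trans (proj₁ (hi-within x 1≤x)) x≤x')

  lo-far : ∀ x → finite (b s) < x → lo x ≡ S
  lo-far x bs<x with m≤n⇒m<n∨m≡n (proj₂ (lo-step x))
  ... | inj₂ lo≡S = lo≡S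
  ... | inj₁ lo<S = ⊥-elim (<⇒≱ (≤-<-trans end≤bs bs<x) x≤end)
    where
    l = lo x
    1≤l = proj₁ (lo-step x)
    l≤s = ≤-pred lo<S
    x≤end : x ≤ finite (b l)
    x≤end with subst (fin x ≤ᵢ_) (b-fin l 1≤l l≤s) (lo-ends-after x)
    ... | fin≤fin x≤n = x≤n
    end≤bs : finite (b l) ≤ finite (b s)
    end≤bs with b-mono l s 1≤l l≤s (n≤1+n s)
    ... | bl≤bs rewrite b-fin l 1≤l l≤s | b-fin s (≤-trans 1≤l l≤s) ≤-refl with bl≤bs
    ... | fin≤fin end≤ = end≤

  -- [a j , b j] is the p j-interval of γ: γ is adjacent to step j in G.
  Adjacent : List ℕ → ℕ → Set
  Adjacent γ j = IsPInterval γ (p j) (a j , b j)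

  adjacent-at : ∀ {γ j} → Adjacent γ j → ∀ y → Within j y → at γ y ≡ p j
  adjacent-at (1≤aj , _ , iff) y (aj≤y , y≤bj) = to (iff (fin y) (≤-trans 1≤aj aj≤y)) (fin≤fin aj≤y , y≤bj)

  -- For a monotone c : ℕ → ℕ, position x gets the value
  -- of the step of [lo x , hi x] nearest to c x.  The resulting list is
  -- admissible, hence in cl(P), and is adjacent only to steps that c chooses
  -- on their whole interval.
  module Follow (c : ℕ → ℕ) (c-mono : ∀ x y → x ≤ y → c x ≤ c y) where

    chosen : ℕ → ℕ
    chosen x = clamp (c x) (lo x) (hi x)

    chosen-range : ∀ x → 1 ≤ x → (lo x ≤ chosen x) × (chosen x ≤ hi x)
    chosen-range x 1≤x = clamp-range (c x) (lo x) (hi x) (lo≤hi x 1≤x)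

    chosen-step : ∀ x → 1 ≤ x → Step (chosen x)
    chosen-step x 1≤x = ≤-trans (proj₁ (lo-step x)) (proj₁ (chosen-range x 1≤x))
                      , ≤-trans (proj₂ (chosen-range x 1≤x)) (proj₂ (hi-step x))

    chosen-within : ∀ x → 1 ≤ x → Within (chosen x) x
    chosen-within x 1≤x = between-within x (chosen x) 1≤x (proj₁ (chosen-range x 1≤x)) (proj₂ (chosen-range x 1≤x))

    chosen-mono : ∀ x x' → 1 ≤ x → x ≤ x' → chosen x ≤ chosen x'
    chosen-mono x x' 1≤x x≤x' =
      clamp-mono (c x) (lo x) (hi x) (c x') (lo x') (hi x')
                 (c-mono x x' x≤x') (lo-mono x x' x≤x') (hi-mono x x' 1≤x x≤x') (lo≤hi x 1≤x)

    value : ℕ → ℕ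
    value x = p (chosen x)

    value-decr : ∀ x → 1 ≤ x → value (suc x) ≤ value x
    value-decr x 1≤x = p-antitone (chosen x) (chosen (suc x)) (chosen-step x 1≤x) (chosen-step (suc x) (s≤s z≤n))
                                  (chosen-mono x (suc x) 1≤x (n≤1+n x))

    open Tabulate value value-decr

    -- every position past the last finite endpoint can only choose step S
    N : ℕ
    N = finite (b s)

    value-vanishes : value (suc N) ≡ 0
    value-vanishes = trans (cong p chosen≡S) p-last
      where
      lo≡S : lo (suc N) ≡ S
      lo≡S = lo-far (suc N) ≤-refl
      hi≡S : hi (suc N) ≡ S
      hi≡S = ≤-antisym (proj₂ (hi-step (suc N))) (subst (_≤ hi (suc N)) lo≡S (lo≤hi (suc N) (s≤s z≤n)))
      chosen≡S : chosen (suc N) ≡ S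
      chosen≡S = ≤-antisym (subst (chosen (suc N) ≤_) hi≡S (proj₂ (chosen-range (suc N) (s≤s z≤n))))
                           (subst (_≤ chosen (suc N)) lo≡S (proj₁ (chosen-range (suc N) (s≤s z≤n))))

    -- only the entries of γ are used: keep the list itself opaque
    abstract
      γ : List ℕ
      γ = values 1 N

      γ-at : ∀ x → 1 ≤ x → at γ x ≡ value x
      γ-at (suc y) _ = values-at N 1 (s≤s z≤n) value-vanishes y

      γ-pos : Pos γ
      γ-pos = values-pos N 1

    γ-admissible : Admissible γ
    γ-admissible = record
      { pos = γ-pos
      ; decr = λ x 1≤x → subst₂ _≤_ (sym (γ-at (suc x) (s≤s z≤n))) (sym (γ-at x 1≤x)) (value-decr x 1≤x)
      ; supported = λ x 1≤x → chosen x , chosen-step x 1≤x , γ-at x 1≤x , chosen-within x 1≤x }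

    γ∈cl : InCl P γ
    γ∈cl = admissible-closure γ γ-admissible

    adjacent-chosen : ∀ j → Step j → Adjacent γ j → ∀ y → 1 ≤ y → Within j y → chosen y ≡ j
    adjacent-chosen j step adjacent y 1≤y within =
      p-injective (chosen y) j (chosen-step y 1≤y) step (trans (sym (γ-at y 1≤y)) (adjacent-at adjacent y within))

    -- An adjacent step j joined to j + 1 is chosen at a (j + 1), where j + 1 is
    -- also available: so c (a (j + 1)) ≤ j.
    adjacent-joined-next : ∀ j → Step j → Adjacent γ j → Joined j → c (a (suc j)) ≤ j
    adjacent-joined-next j step adjacent joined =
      clamp-below-hi (c y) (lo y) (hi y) j (hi-greatest y (suc j) 1≤y next-step ≤-refl)
                     (adjacent-chosen j step adjacent y 1≤y (joined-within j step joined))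
      where
      y = a (suc j)
      next-step : Step (suc j)
      next-step = s≤s z≤n , s≤s (joined-before-last j step joined)
      1≤y = a-pos (suc j) next-step

    -- An adjacent step k + 1 with k joined to it is chosen at a (k + 1), where
    -- k is also available: so k + 1 ≤ c (a (k + 1)).
    adjacent-joined-prev : ∀ k → 1 ≤ k → Step (suc k) → Adjacent γ (suc k) → Joined k → suc k ≤ c (a (suc k))
    adjacent-joined-prev k 1≤k step adjacent joined =
      clamp-above-lo (c y) (lo y) (hi y) (suc k)
        (s≤s (lo-least y k (1≤k , m≤n⇒m≤1+n (≤-pred (proj₂ step))) (subst (fin y ≤ᵢ_) (sym joined) ≤ᵢ-refl)))
        (adjacent-chosen (suc k) step adjacent y (a-pos (suc k) step) (within-start (suc k) step))
      where y = a (suc k)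

    adjacent-only-chosen : ∀ j t → Step j → Step t → block t ≡ block j →
                           (∀ y → Within j y → c y ≡ t) → Adjacent γ j → j ≡ t
    adjacent-only-chosen j t step step-t same-block c≡t adjacent with <-cmp j t
    ... | tri≈ _ j≡t _ = j≡t
    ... | tri< j<t _ _ =
      ⊥-elim (<⇒≱ j<t (subst (_≤ j) (c≡t _ (joined-within j step joined)) (adjacent-joined-next j step adjacent joined)))
      where joined = block-joined j t j<t (sym same-block)
    adjacent-only-chosen (suc k) t step step-t same-block c≡t adjacent | tri> _ _ (s≤s t≤k) =
      ⊥-elim (<⇒≱ (s≤s t≤k) (subst (suc k ≤_) (c≡t _ (within-start (suc k) step))
                (adjacent-joined-prev k (≤-trans (proj₁ step-t) t≤k) step adjacent joined)))
      where
      joined : Joined k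
      joined = block-joined k (suc k) ≤-refl
        (trans (block-between t k (suc k) t≤k (n≤1+n k) same-block) same-block)

  -- In an admissible γ, take the last step j of
  -- a block with γ_{a j} ≤ p j (the first step of the block qualifies).
  -- Then γ is adjacent to j: it equals p j exactly on [a j , b j].
  Low : List ℕ → ℕ → ℕ → Set
  Low γ β k = ((1 ≤ k) × (block k ≡ β)) × (at γ (a k) ≤ p k)

  module LastLow (γ : List ℕ) (adm : Admissible γ) (β j : ℕ) (step : Step j) (j-low : Low γ β j)
                 (last : ∀ k → j < k → k ≤ S → ¬ Low γ β k) where
    open Admissible adm

    j-block = proj₂ (proj₁ j-low)
    1≤aj = a-pos j step

    at-start : at γ (a j) ≡ p j
    at-start with supported (a j) 1≤aj
    ... | (j' , step' , γ≡pj' , within') = trans γ≡pj' (cong p (≤-antisym j'≤j j≤j'))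
      where
      j≤j' : j ≤ j'
      j≤j' = p-reflects j j' step step' (subst (_≤ p j) γ≡pj' (proj₂ j-low))
      j'-block : block j' ≡ β
      j'-block = trans (sym (shared-position j j' step step' (a j) (within-start j step) within')) j-block
      aj'≡aj : a j' ≡ a j
      aj'≡aj = ≤-antisym (proj₁ within') (a-mono j j' (proj₁ step) j≤j' (proj₂ step'))
      j'≤j : j' ≤ j
      j'≤j = ≮⇒≥ λ j<j' → last j' j<j' (proj₂ step')
               ((proj₁ step' , j'-block) , subst (λ z → at γ z ≤ p j') (sym aj'≡aj) (≤-reflexive γ≡pj'))

    -- at a finite end n of its interval, γ still takes the value p j: a
    -- smaller value would belong to a later step j'' of the block, making
    -- j + 1 a later low step
    start≤end : ∀ n → b j ≡ fin n → a j ≤ n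
    start≤end n bj≡n with subst (fin (a j) ≤ᵢ_) bj≡n (a≤b j (proj₁ step) (proj₂ step))
    ... | fin≤fin aj≤n = aj≤n

    at-end : ∀ n → b j ≡ fin n → at γ n ≡ p j
    at-end n bj≡n with supported n (≤-trans 1≤aj (start≤end n bj≡n))
    ... | (j'' , step'' , γn≡ , within'') = trans γn≡ (cong p j''≡j)
      where
      aj≤n = start≤end n bj≡n
      n-within : Within j n
      n-within = aj≤n , subst (fin n ≤ᵢ_) (sym bj≡n) ≤ᵢ-refl
      j≤j'' : j ≤ j''
      j≤j'' = p-reflects j j'' step step''
                (subst (_≤ p j) γn≡ (subst (at γ n ≤_) at-start (decr-antitone γ decr (a j) n 1≤aj aj≤n)))
      later-low : j < j'' → ⊥
      later-low j<j'' = last (suc j) ≤-refl (≤-trans j<j'' (proj₂ step''))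
                          ((s≤s z≤n , trans (joined-block j joined) j-block) , next-low)
        where
        joined : Joined j
        joined = block-joined j j'' j<j'' (shared-position j j'' step step'' n n-within within'')
        n≡next : n ≡ a (suc j)
        n≡next with trans (sym bj≡n) joined
        ... | refl = refl
        next-low : at γ (a (suc j)) ≤ p (suc j)
        next-low = subst (λ z → at γ z ≤ p (suc j)) n≡next
                     (subst (_≤ p (suc j)) (sym γn≡)
                       (p-antitone (suc j) j'' (s≤s z≤n , ≤-trans j<j'' (proj₂ step'')) step'' j<j''))
      j''≡j : j'' ≡ j
      j''≡j with m≤n⇒m<n∨m≡n j≤j''
      ... | inj₂ j≡j'' = sym j≡j''
      ... | inj₁ j<j'' = ⊥-elim (later-low j<j'')

    at-least : ∀ y → 1 ≤ y → ∀ e → b j ≡ e → fin y ≤ᵢ e → p j ≤ at γ y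
    at-least y 1≤y (fin n) bj≡n (fin≤fin y≤n) = subst (_≤ at γ y) (at-end n bj≡n) (decr-antitone γ decr y n 1≤y y≤n)
    at-least y 1≤y ∞ bj≡∞ _ with b-∞ j step bj≡∞
    ... | refl = subst (_≤ at γ y) (sym p-last) z≤n

    adjacent : Adjacent γ j
    adjacent = 1≤aj , a≤b j (proj₁ step) (proj₂ step) , iff
      where
      iff : ∀ i → ValidIdx i → (i ∈ᴵ (a j , b j)) ⇔ (val γ i ≡ p j)
      iff (fin y) 1≤y = mk⇔ inside outside
        where
        inside : fin y ∈ᴵ (a j , b j) → at γ y ≡ p j
        inside (fin≤fin aj≤y , y≤bj) =
          ≤-antisym (subst (at γ y ≤_) at-start (decr-antitone γ decr (a j) y 1≤aj aj≤y)) (at-least y 1≤y (b j) refl y≤bj)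
        outside : at γ y ≡ p j → fin y ∈ᴵ (a j , b j)
        outside γy≡pj with supported y 1≤y
        ... | (m , step-m , γy≡pm , (am≤y , y≤bm)) with p-injective m j step-m step (trans (sym γy≡pm) γy≡pj)
        ... | refl = fin≤fin am≤y , y≤bm
      iff ∞ _ = mk⇔ (λ { (_ , ∞≤bj) → infinite (b j) refl ∞≤bj }) zero-value
        where
        infinite : ∀ e → b j ≡ e → ∞ ≤ᵢ e → 0 ≡ p j
        infinite ∞ bj≡∞ ∞≤∞ with b-∞ j step bj≡∞
        ... | refl = sym p-last
        zero-value : 0 ≡ p j → ∞ ∈ᴵ (a j , b j)
        zero-value 0≡pj with p-zero j step (sym 0≡pj)
        ... | refl = fin≤∞ , subst (∞ ≤ᵢ_) (sym b-last) ∞≤∞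

  record BlockRange (m0 : ℕ) : Set where
    field
      off last : ℕ
      first-step : Step (suc off)
      last-step : Step last
      first-block : block (suc off) ≡ block m0
      last-block : block last ≡ block m0
      bounds : ∀ m → Step m → block m ≡ block m0 → (suc off ≤ m) × (m ≤ last)

  InSameBlock : ℕ → ℕ → Set
  InSameBlock β m = (1 ≤ m) × (block m ≡ β)

  in-same-block? : ∀ β m → Dec (InSameBlock β m)
  in-same-block? β m = (1 ≤? m) ×-dec (block m ℕ.≟ β)

  -- only the specification of the range is used: keep it opaque
  abstract
    block-range : ∀ m0 → Step m0 → BlockRange m0
    block-range m0 (1≤m0 , m0≤S) = range (Search.least same? S m0-same) (Search.greatest same? S m0-same)
      where
      same? : ∀ m → Dec (InSameBlock (block m0) m)
      same? = in-same-block? (block m0)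
      m0-same : ∃ λ m → m ≤ S × InSameBlock (block m0) m
      m0-same = (m0 , m0≤S , 1≤m0 , refl)
      range : (∃ λ m → InSameBlock (block m0) m × m ≤ S × (∀ k → k < m → ¬ InSameBlock (block m0) k)) →
              (∃ λ m → InSameBlock (block m0) m × m ≤ S × (∀ k → m < k → k ≤ S → ¬ InSameBlock (block m0) k)) →
              BlockRange m0
      range (zero , (() , _) , _) _
      range (suc off , (1≤first , first-block) , first≤S , before) (last , (1≤last , last-block) , last≤S , after) =
        record
          { off = off ; last = last ; first-step = 1≤first , first≤S ; last-step = 1≤last , last≤S
          ; first-block = first-block ; last-block = last-block
          ; bounds = λ m (1≤m , m≤S) same → ≮⇒≥ (λ m<first → before m m<first (1≤m , same))
                                          , ≮⇒≥ (λ last<m → after m last<m m≤S (1≤m , same)) }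

  first-low : ∀ γ → Admissible γ → ∀ i → Step i → (∀ m → Step m → block m ≡ block i → i ≤ m) → Low γ (block i) i
  first-low γ adm i step-i first with Admissible.supported adm (a i) (a-pos i step-i)
  ... | (m , step-m , γ≡pm , within) =
    (proj₁ step-i , refl) , subst (_≤ p i) (sym γ≡pm) (p-antitone i m step-i step-m (first m step-m same-block))
    where
    same-block = shared-position m i step-m step-i (a i) within (within-start i step-i)

  block-adjacent : ∀ γ → InCl P γ → ∀ m0 → Step m0 → ∃ λ j → Step j × (block j ≡ block m0) × Adjacent γ j
  block-adjacent γ γ∈cl m0 step0 = last-low-adjacent (Search.greatest low? S (suc off , proj₂ first-step , first-is-low))
    where
    open BlockRange (block-range m0 step0)
    adm = closure-admissible γ∈cl
    low? : ∀ k → Dec (Low γ (block m0) k)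
    low? k = in-same-block? (block m0) k ×-dec (at γ (a k) ≤? p k)
    first-is-low : Low γ (block m0) (suc off)
    first-is-low = subst (λ β → Low γ β (suc off)) first-block
      (first-low γ adm (suc off) first-step
        λ m step-m same → proj₁ (bounds m step-m (trans same first-block)))
    last-low-adjacent : (∃ λ j → Low γ (block m0) j × j ≤ S × (∀ k → j < k → k ≤ S → ¬ Low γ (block m0) k)) →
                        ∃ λ j → Step j × (block j ≡ block m0) × Adjacent γ j
    last-low-adjacent (j , j-low , j≤S , after) =
      j , step-j , proj₂ (proj₁ j-low) , LastLow.adjacent γ adm (block m0) j step-j j-low after
      where step-j = proj₁ (proj₁ j-low) , j≤S

  InBlock : ℕ → Elem → Set
  InBlock m0 x = ∃ λ m → Step m × (block m ≡ block m0) × (x ≡ elem m)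

  IsBlock : List Elem → ℕ → Set
  IsBlock Y m0 = ∀ x → x ∈ Y ⇔ InBlock m0 x

  Enumerated : ℕ → ℕ → Elem → Set
  Enumerated off r x = ∃ λ j → (1 ≤ j) × (j ≤ r) × (x ≡ elem (off + j))

  steps : ℕ → ℕ → List Elem
  steps off zero = []
  steps off (suc r) = elem (off + suc r) ∷ steps off r

  steps-enumerated : ∀ off r x → x ∈ steps off r ⇔ Enumerated off r x
  steps-enumerated off r x = mk⇔ (listed r) (enumerated r)
    where
    listed : ∀ r → x ∈ steps off r → Enumerated off r x
    listed (suc r) (here x≡) = suc r , s≤s z≤n , ≤-refl , x≡
    listed (suc r) (there x∈) = let (j , 1≤j , j≤r , x≡) = listed r x∈ in j , 1≤j , m≤n⇒m≤1+n j≤r , x≡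
    enumerated : ∀ r → Enumerated off r x → x ∈ steps off r
    enumerated zero (j , 1≤j , j≤0 , _) = ⊥-elim (<⇒≱ 1≤j j≤0)
    enumerated (suc r) (j , 1≤j , j≤ , x≡) with m≤n⇒m<n∨m≡n j≤
    ... | inj₂ refl = here x≡
    ... | inj₁ j<1+r = there (enumerated r (j , 1≤j , ≤-pred j<1+r , x≡))

  module Enumerate (m0 : ℕ) (step0 : Step m0) where
    open BlockRange (block-range m0 step0) public

    size : ℕ
    size = last ∸ off

    off≤last : off ≤ last
    off≤last = ≤-trans (n≤1+n off) (≤-trans (proj₁ (bounds m0 step0 refl)) (proj₂ (bounds m0 step0 refl)))

    nth-bounds : ∀ j → 1 ≤ j → j ≤ size → (suc off ≤ off + j) × (off + j ≤ last)
    nth-bounds (suc j) _ j≤size =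
      subst (suc off ≤_) (sym (+-suc off j)) (s≤s (m≤m+n off j)) ,
      ≤-trans (+-monoʳ-≤ off j≤size) (≤-reflexive (m+[n∸m]≡n off≤last))

    nth-block : ∀ j → 1 ≤ j → j ≤ size → Step (off + j) × (block (off + j) ≡ block m0)
    nth-block j 1≤j j≤size =
      (≤-trans (s≤s z≤n) first≤ , ≤-trans ≤last (proj₂ last-step)) ,
      trans (block-between (suc off) (off + j) last first≤ ≤last (trans first-block (sym last-block))) first-block
      where
      first≤ = proj₁ (nth-bounds j 1≤j j≤size)
      ≤last = proj₂ (nth-bounds j 1≤j j≤size)

    enumerate : ∀ x → InBlock m0 x ⇔ Enumerated off size x
    enumerate x = mk⇔ index nth
      where
      index : InBlock m0 x → Enumerated off size x
      index (m , step-m , same , x≡) =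
        m ∸ off , m<n⇒0<n∸m (proj₁ (bounds m step-m same)) , ∸-monoˡ-≤ off (proj₂ (bounds m step-m same)) ,
        trans x≡ (cong elem (sym (m+[n∸m]≡n (≤-trans (n≤1+n off) (proj₁ (bounds m step-m same))))))
      nth : Enumerated off size x → InBlock m0 x
      nth (j , 1≤j , j≤size , x≡) = off + j , proj₁ (nth-block j 1≤j j≤size) , proj₂ (nth-block j 1≤j j≤size) , x≡

    block-list : List Elem
    block-list = steps off size

    block-list-is-block : IsBlock block-list m0
    block-list-is-block x = mk⇔ (λ x∈ → from (enumerate x) (to (steps-enumerated off size x) x∈))
                                (λ inblock → from (steps-enumerated off size x) (to (enumerate x) inblock))

    -- consecutive steps of the block are joined, so they form an overlapping segment
    consecutive : ∀ j → 1 ≤ j → suc j ≤ size →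
                  (p (off + suc j) < p (off + j)) × (fin (a (off + suc j)) ≡ b (off + j))
    consecutive j 1≤j j+1≤size rewrite +-suc off j = p-step m (proj₁ step-m) m≤s , sym joined
      where
      m = off + j
      current = nth-block j 1≤j (≤-trans (n≤1+n j) j+1≤size)
      next = subst (λ k → Step k × (block k ≡ block m0)) (+-suc off j) (nth-block (suc j) (s≤s z≤n) j+1≤size)
      step-m = proj₁ current
      m≤s : m ≤ s
      m≤s = ≤-pred (proj₂ (proj₁ next))
      joined : Joined m
      joined = block-joined m (suc m) ≤-refl (trans (proj₂ current) (sym (proj₂ next)))

  -- Overlapping segments lie inside one block: consecutive elements of a
  -- segment are steps whose intervals share the position a m'.
  segment-link : ∀ m m' → Step m → Step m' → p m' < p m → fin (a m') ≡ b m → block m ≡ block m'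
  segment-link m m' step step' pm'<pm am'≡bm =
    shared-position m m' step step' (a m')
      (a-mono m m' (proj₁ step) (p-reflects m m' step step' (<⇒≤ pm'<pm)) (proj₂ step') ,
       subst (fin (a m') ≤ᵢ_) am'≡bm ≤ᵢ-refl)
      (within-start m' step')

  module Segment (Z : List Elem) (segment : IsOverlappingSegment P Z) where
    Z⊆pr = proj₁ segment
    r = proj₁ (proj₂ segment)
    q = proj₁ (proj₂ (proj₂ segment))
    J = proj₁ (proj₂ (proj₂ (proj₂ segment)))
    listing = proj₁ (proj₂ (proj₂ (proj₂ (proj₂ segment))))
    chain = proj₂ (proj₂ (proj₂ (proj₂ (proj₂ segment))))

    nth-step : ∀ j → 1 ≤ j → j ≤ r → ∃ λ m → Step m × ((q j , J j) ≡ elem m)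
    nth-step j 1≤j j≤r = profile-step _ (Z⊆pr _ (from (listing _) (j , 1≤j , j≤r , refl)))

    nth-block : ∀ j → 1 ≤ j → j ≤ r → ∀ m m₁ → Step m → Step m₁ →
                (q j , J j) ≡ elem m → (q 1 , J 1) ≡ elem m₁ → block m ≡ block m₁
    nth-block (suc zero) _ _ m m₁ step step₁ x≡ x₁≡ =
      cong block (p-injective m m₁ step step₁ (cong proj₁ (trans (sym x≡) x₁≡)))
    nth-block (suc (suc j)) _ j+2≤r m' m₁ step' step₁ x'≡ x₁≡ =
      trans (sym link) (nth-block (suc j) (s≤s z≤n) j+1≤r m m₁ step step₁ x≡ x₁≡)
      where
      j+1≤r = ≤-trans (n≤1+n _) j+2≤r
      previous = nth-step (suc j) (s≤s z≤n) j+1≤r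
      m = proj₁ previous
      step = proj₁ (proj₂ previous)
      x≡ = proj₂ (proj₂ previous)
      link : block m ≡ block m'
      link = segment-link m m' step step'
        (subst₂ _<_ (cong proj₁ x'≡) (cong proj₁ x≡) (proj₁ (chain (suc j) (s≤s z≤n) j+2≤r)))
        (subst₂ (λ u v → fin u ≡ v) (cong (λ z → proj₁ (proj₂ z)) x'≡) (cong (λ z → proj₂ (proj₂ z)) x≡)
                (proj₂ (chain (suc j) (s≤s z≤n) j+2≤r)))

    same-block : ∀ x x' m m' → x ∈ Z → x' ∈ Z → Step m → Step m' → x ≡ elem m → x' ≡ elem m' → block m ≡ block m'
    same-block x x' m m' x∈Z x'∈Z step step' x≡ x'≡ with to (listing x) x∈Z | to (listing x') x'∈Z
    ... | (j , 1≤j , j≤r , x≡j) | (j' , 1≤j' , j'≤r , x'≡j') with nth-step 1 ≤-refl (≤-trans 1≤j j≤r)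
    ... | (m₁ , step₁ , x₁≡) = trans (nth-block j 1≤j j≤r m m₁ step step₁ (trans (sym x≡j) x≡) x₁≡)
                                     (sym (nth-block j' 1≤j' j'≤r m' m₁ step' step₁ (trans (sym x'≡j') x'≡) x₁≡))

  block-⊆pr : ∀ Y m0 → IsBlock Y m0 → SubPr P Y
  block-⊆pr Y m0 Y-block x x∈Y with to (Y-block x) x∈Y
  ... | (m , step , _ , refl) = step-profile m step

  block-max-segment : ∀ Y m0 → Step m0 → IsBlock Y m0 → IsMaxOverlappingSegment P Y
  block-max-segment Y m0 step0 Y-block = segment , maximal
    where
    open Enumerate m0 step0
    listing : ∀ x → x ∈ Y ⇔ Enumerated off size x
    listing x = mk⇔ (λ x∈Y → to (enumerate x) (to (Y-block x) x∈Y)) (λ e → from (Y-block x) (from (enumerate x) e))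
    segment : IsOverlappingSegment P Y
    segment = block-⊆pr Y m0 Y-block , size , (λ j → p (off + j)) , (λ j → (a (off + j) , b (off + j))) ,
              listing , consecutive
    maximal : ∀ Z → IsOverlappingSegment P Z → Y ⊆ Z → Z ⊆ Y
    maximal Z Z-segment Y⊆Z {x} x∈Z with profile-step x (proj₁ Z-segment x x∈Z)
    ... | (m , step , x≡) =
      from (Y-block x) (m , step , Segment.same-block Z Z-segment x (elem m0) m m0 x∈Z m0∈Z step step0 x≡ refl , x≡)
      where
      m0∈Z : elem m0 ∈ Z
      m0∈Z = Y⊆Z (from (Y-block (elem m0)) (m0 , step0 , refl , refl))

  block-list-segment : ∀ m0 step0 → IsOverlappingSegment P (Enumerate.block-list m0 step0)
  block-list-segment m0 step0 =
    proj₁ (block-max-segment (Enumerate.block-list m0 step0) m0 step0 (Enumerate.block-list-is-block m0 step0))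

  -- each maximal overlapping segment is a block (it is nonempty, as [] lies
  -- inside the segment formed by the block of step 1)
  max-segment-block : ∀ Y → IsMaxOverlappingSegment P Y → ∃ λ m0 → Step m0 × IsBlock Y m0
  max-segment-block [] (_ , maximal)
    with maximal (block-list 1 step-1) (block-list-segment 1 step-1) (λ ())
                 (from (block-list-is-block 1 step-1 (elem 1)) (1 , step-1 , refl , refl))
    where open Enumerate using (block-list; block-list-is-block)
  ... | ()
  max-segment-block (y ∷ ys) (segment , maximal) with profile-step y (proj₁ segment y (here refl))
  ... | (m0 , step0 , y≡) = m0 , step0 , λ x → mk⇔ (inside x) (contains x)
    where
    open Enumerate m0 step0
    inside : ∀ x → x ∈ y ∷ ys → InBlock m0 x
    inside x x∈Y with profile-step x (proj₁ segment x x∈Y)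
    ... | (m , step , x≡) = m , step , Segment.same-block (y ∷ ys) segment x y m m0 x∈Y (here refl) step step0 x≡ y≡ , x≡
    contains : ∀ x → InBlock m0 x → x ∈ y ∷ ys
    contains x inblock =
      maximal block-list (block-list-segment m0 step0)
              (λ {z} z∈Y → from (block-list-is-block z) (inside z z∈Y)) (from (block-list-is-block x) inblock)

  block-covers : ∀ Y m0 → Step m0 → IsBlock Y m0 → Covers P Y
  block-covers Y m0 step0 Y-block γ γ∈cl with block-adjacent γ γ∈cl m0 step0
  ... | (j , step , same , adjacent) = p j , (a j , b j) , from (Y-block (elem j)) (j , step , same , refl) , adjacent

  -- (2) If Y ⊆ pr(P) misses a step of every block, Y does not cover cl(P):
  -- following the first missing step of each block yields a list in cl(P)
  -- adjacent to no element of Y.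
  Missing : List Elem → ℕ → ℕ → Set
  Missing Y m m' = InSameBlock (block m) m' × ¬ (elem m' ∈ Y)

  missing? : ∀ Y m m' → Dec (Missing Y m m')
  missing? Y m m' = in-same-block? (block m) m' ×-dec ¬? (elem m' ∈? Y)

  module Avoid (Y : List Elem) (Y⊆pr : SubPr P Y) (missing : ∀ m → Step m → ∃ λ m' → m' ≤ S × Missing Y m m') where

    -- only the specification of the search is used: keep it opaque
    abstract
      first-missing : ∀ m → Step m → ∃ λ m' → Missing Y m m' × m' ≤ S × (∀ k → k < m' → ¬ Missing Y m k)
      first-missing m step = Search.least (missing? Y m) S (missing m step)

    choice : ∀ m → Step m → ℕ
    choice m step = proj₁ (first-missing m step)

    choice-step : ∀ m step → Step (choice m step)
    choice-step m step = proj₁ (proj₁ (proj₁ (proj₂ (first-missing m step))))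
                       , proj₁ (proj₂ (proj₂ (first-missing m step)))

    choice-block : ∀ m step → block (choice m step) ≡ block m
    choice-block m step = proj₂ (proj₁ (proj₁ (proj₂ (first-missing m step))))

    choice-missing : ∀ m step → ¬ (elem (choice m step) ∈ Y)
    choice-missing m step = proj₂ (proj₁ (proj₂ (first-missing m step)))

    choice-least : ∀ m step m' step' → block m ≡ block m' → choice m step ≤ choice m' step'
    choice-least m step m' step' same =
      ≮⇒≥ λ lt → proj₂ (proj₂ (proj₂ (first-missing m step))) (choice m' step') lt
                   ((proj₁ (choice-step m' step') , trans (choice-block m' step') (sym same)) , choice-missing m' step')

    choice-same : ∀ m step m' step' → block m ≡ block m' → choice m step ≡ choice m' step'
    choice-same m step m' step' same = ≤-antisym (choice-least m step m' step' same) (choice-least m' step' m step (sym same))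

    choice-mono : ∀ m step m' step' → m ≤ m' → choice m step ≤ choice m' step'
    choice-mono m step m' step' m≤m' with block m ℕ.≟ block m'
    ... | yes same = choice-least m step m' step' same
    ... | no different = <⇒≤ (≰⇒> λ later≤ → <⇒≱ (≤∧≢⇒< (block-mono m m' m≤m') different)
            (subst₂ _≤_ (choice-block m' step') (choice-block m step) (block-mono _ _ later≤)))

    c : ℕ → ℕ
    c x = choice (lo x) (lo-step x)

    c-mono : ∀ x y → x ≤ y → c x ≤ c y
    c-mono x y x≤y = choice-mono (lo x) (lo-step x) (lo y) (lo-step y) (lo-mono x y x≤y)

    open Follow c c-mono

    c-within : ∀ j step y → Within j y → c y ≡ choice j step
    c-within j step y within =
      choice-same (lo y) (lo-step y) j step
        (shared-position (lo y) j (lo-step y) step y (lo-within y 1≤y) within)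
      where 1≤y = ≤-trans (a-pos j step) (proj₁ within)

    not-covered : ¬ Covers P Y
    not-covered covers with covers γ γ∈cl
    ... | (q , I , x∈Y , adjacent) with profile-step (q , I) (Y⊆pr _ x∈Y)
    ... | (j , step , refl) =
      choice-missing j step (subst (λ k → elem k ∈ Y) j≡choice x∈Y)
      where
      j≡choice : j ≡ choice j step
      j≡choice = adjacent-only-chosen j (choice j step) step (choice-step j step) (choice-block j step)
                   (c-within j step) adjacent

  element-block : ∀ Y m0 m → IsBlock Y m0 → Step m → elem m ∈ Y → block m ≡ block m0
  element-block Y m0 m Y-block step m∈Y with to (Y-block (elem m)) m∈Y
  ... | (m' , step' , same , m≡m') = trans (cong block (p-injective m m' step step' (cong proj₁ m≡m'))) same

  -- a proper subset of a block misses a step of every block, so it does not cover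
  block-minimal : ∀ Y m0 → IsBlock Y m0 → ∀ Z → Z ⊆ Y → ¬ (Y ⊆ Z) → ¬ Covers P Z
  block-minimal Y m0 Y-block Z Z⊆Y Y⊈Z with not-⊆-witness Y Z Y⊈Z
  ... | (x , x∈Y , x∉Z) with to (Y-block x) x∈Y
  ... | (j , step-j , j-block , refl) = Avoid.not-covered Z (λ z z∈Z → block-⊆pr Y m0 Y-block z (Z⊆Y z∈Z)) missing
    where
    missing : ∀ m → Step m → ∃ λ m' → m' ≤ S × Missing Z m m'
    missing m step with block m ℕ.≟ block m0
    ... | yes same = j , proj₂ step-j , (proj₁ step-j , trans j-block (sym same)) , x∉Z
    ... | no different = m , proj₂ step , (proj₁ step , refl) ,
                         λ m∈Z → different (element-block Y m0 m Y-block step (Z⊆Y m∈Z))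

  block-cl-minimal : ∀ Y m0 → Step m0 → IsBlock Y m0 → ClMinimal P Y
  block-cl-minimal Y m0 step0 Y-block = block-⊆pr Y m0 Y-block , block-covers Y m0 step0 Y-block , block-minimal Y m0 Y-block

  -- A cl(P)-minimal Y cannot miss a step of every block by (2), so it
  -- contains a block; that block covers by (1), so by minimality Y is it.
  Complete : List Elem → ℕ → Set
  Complete Y m0 = (1 ≤ m0) × ¬ (∃ λ m' → m' ≤ S × Missing Y m0 m')

  minimal-block : ∀ Y → ClMinimal P Y → ∃ λ m0 → Step m0 × IsBlock Y m0
  minimal-block Y (Y⊆pr , covers , minimal) with Search.below? complete? S
    where
    complete? : ∀ m → Dec (Complete Y m)
    complete? m = (1 ≤? m) ×-dec ¬? (Search.below? (missing? Y m) S)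
  ... | no none = ⊥-elim (Avoid.not-covered Y Y⊆pr some-missing covers)
    where
    some-missing : ∀ m → Step m → ∃ λ m' → m' ≤ S × Missing Y m m'
    some-missing m (1≤m , m≤S) =
      decidable-stable (Search.below? (missing? Y m) S) (λ absent → none (m , m≤S , 1≤m , absent))
  ... | yes (m0 , m0≤S , 1≤m0 , complete) = m0 , step0 , λ x → mk⇔ (λ x∈Y → to (block-list-is-block x) (Y⊆block x∈Y)) (in-Y x)
    where
    step0 = 1≤m0 , m0≤S
    open Enumerate m0 step0
    in-Y : ∀ x → InBlock m0 x → x ∈ Y
    in-Y x (m , step , same , refl) =
      decidable-stable (elem m ∈? Y) (λ m∉Y → complete (m , proj₂ step , (proj₁ step , same) , m∉Y))
    block⊆Y : block-list ⊆ Y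
    block⊆Y {x} x∈block = in-Y x (to (block-list-is-block x) x∈block)
    Y⊆block : Y ⊆ block-list
    Y⊆block = decidable-stable (Y ⊆? block-list)
                (λ Y⊈ → minimal block-list block⊆Y Y⊈ (block-covers block-list m0 step0 block-list-is-block))

  minimal⇔max-segment : ∀ Y → ClMinimal P Y ⇔ IsMaxOverlappingSegment P Y
  minimal⇔max-segment Y = mk⇔
    (λ minimal → let (m0 , step0 , Y-block) = minimal-block Y minimal in block-max-segment Y m0 step0 Y-block)
    (λ max-segment → let (m0 , step0 , Y-block) = max-segment-block Y max-segment in block-cl-minimal Y m0 step0 Y-block)

lemma4p14 : (P : List Partition) → P ≢ [] → All IsPartition P →
    IsStaircase P →
    (Y : List Elem) → (ClMinimal P Y ⇔ IsMaxOverlappingSegment P Y)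
lemma4p14 P _ partitions (s , p , a , b , profile , p-step , p-last , _ , a-first , _ , a≤b , b-last , b-next) =
  Staircase.minimal⇔max-segment P partitions s p a b profile p-step p-last a-first a≤b b-last b-next
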